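{- For all $d \ge 3$, $$B^1_{12\ldots d}(x) = \frac{x^d}{(1-x)^2(1-x-x^2)^{d-2}}.$$
   Context: $S_n$ is the set of permutations of $\{1,\dots,n\}$ in one-line notation. A permutation contains a pattern $\sigma\in S_k$ via each subsequence of length $k$ whose entries are in the same relative order as $\sigma$ (an occurrence); it avoids $\sigma$ if there is no occurrence. $\mathcal{P}_n(132)$ is the set of permutations in $S_n$ avoiding each of $132$, $2341$, $3241$ (equivalently, the two-stack sortable permutations avoiding $132$). For a pattern $\tau$, $B^1_\tau(x)=\sum_{n\ge 0}b_n x^n$ where $b_n$ is the number of permutations in $\mathcal{P}_n(132)$ containing exactly one occurrence of $\tau$. $12\ldots d$ is the increasing pattern of length $d$. -}

module Defs where

open import Data.Nat using (ℕ; zero; suc; _+_; _∸_; _<ᵇ_; _≡ᵇ_)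
open import Data.Bool using (Bool; true; false; _∧_; not; if_then_else_)
open import Data.List using (List; []; _∷_; map; concatMap; length; filter; filterᵇ; upTo)
open import Data.List.Properties using (≡-dec)
open import Data.Nat.Properties using (_≟_)
open import Relation.Nullary.Decidable using (⌊_⌋)
open import Data.Integer using (ℤ; +_; -_) renaming (_+_ to _+ℤ_; _*_ to _*ℤ_)

insertions : ℕ → List ℕ → List (List ℕ)
insertions x [] = (x ∷ []) ∷ []
insertions x (y ∷ ys) = (x ∷ y ∷ ys) ∷ map (y ∷_) (insertions x ys)

perms : List ℕ → List (List ℕ)
perms [] = [] ∷ []
perms (x ∷ xs) = concatMap (insertions x) (perms xs)

oneTo : ℕ → List ℕ
oneTo n = map suc (upTo n)

S : ℕ → List (List ℕ)
S n = perms (oneTo n)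

-- all subsequences of length k, one per choice of k positions
subseqs : ℕ → List ℕ → List (List ℕ)
subseqs zero _ = [] ∷ []
subseqs (suc k) [] = []
subseqs (suc k) (x ∷ xs) = map (x ∷_) (subseqs k xs) ++' subseqs (suc k) xs
  where
  _++'_ : List (List ℕ) → List (List ℕ) → List (List ℕ)
  [] ++' ys = ys
  (a ∷ as) ++' ys = a ∷ (as ++' ys)

countLess : ℕ → List ℕ → ℕ
countLess x ys = length (filter (λ y → y Data.Nat.<? x) ys)
  where import Data.Nat

standardize : List ℕ → List ℕ
standardize xs = map (λ x → suc (countLess x xs)) xs

occurrences : List ℕ → List ℕ → ℕ
occurrences σ π = length (filter (λ s → ≡-dec _≟_ (standardize s) σ) (subseqs (length σ) π))

avoids : List ℕ → List ℕ → Bool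
avoids π σ = occurrences σ π ≡ᵇ 0

inP132 : List ℕ → Bool
inP132 π = avoids π (1 ∷ 3 ∷ 2 ∷ []) ∧ avoids π (2 ∷ 3 ∷ 4 ∷ 1 ∷ []) ∧ avoids π (3 ∷ 2 ∷ 4 ∷ 1 ∷ [])

b : List ℕ → ℕ → ℕ
b τ n = length (filterᵇ (λ π → inP132 π ∧ (occurrences τ π ≡ᵇ 1)) (S n))

incPat : ℕ → List ℕ
incPat d = oneTo d

Series : Set
Series = ℕ → ℤ

sumTo : ℕ → (ℕ → ℤ) → ℤ
sumTo zero f = f 0
sumTo (suc n) f = sumTo n f +ℤ f (suc n)

_⊛_ : Series → Series → Series
(f ⊛ g) n = sumTo n (λ k → f k *ℤ g (n ∸ k))

oneS : Series
oneS zero = + 1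
oneS (suc _) = + 0

_^S_ : Series → ℕ → Series
f ^S zero = oneS
f ^S suc m = f ⊛ (f ^S m)

xPow : ℕ → Series
xPow d n = if n ≡ᵇ d then + 1 else + 0

oneMinusX : Series
oneMinusX zero = + 1
oneMinusX (suc zero) = - (+ 1)
oneMinusX (suc (suc _)) = + 0

oneMinusXMinusX² : Series
oneMinusXMinusX² zero = + 1
oneMinusXMinusX² (suc zero) = - (+ 1)
oneMinusXMinusX² (suc (suc zero)) = - (+ 1)
oneMinusXMinusX² (suc (suc (suc _))) = + 0

B¹ : List ℕ → Series
B¹ τ n = + (b τ n)

-- Inserting n + 1 in all positions of all permutations of 1…n enumerates S (n + 1). For
-- σ = s₀ ∷ σ′ in P(132) the result stays in P(132) only in front, at the end, or directly after s₀
-- when s₀ is the largest entry of σ; any other position creates a 132, 2341 or 3241. A new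
-- maximum in front of σ or directly after its maximal head creates no occurrence of 12…k for
-- k ≥ 3, while one at the end adds exactly the occurrences of 12…(k − 1); since an occurrence of
-- 12…k contains two of 12…(k − 1), the extended permutation has a unique 12…k iff σ had a unique
-- 12…(k − 1). Permutations with maximal head are exactly the insertions in front, so the number
-- T k n of permutations in P_n(132) with exactly one 12…k satisfies
--   T k (n + 2) = T k (n + 1) + T k n + T (k − 1) (n + 1)  for k ≥ 3,  and  T 2 (n + 1) = n,
-- that is (1 − x − x²) B_k = x B_(k−1) and (1 − x)² B_2 = x².

module Submission where

open import Defs
open import Data.Nat.Properties
open import Algebra.Properties.CommutativeSemigroup +-commutativeSemigroup using (interchange)
open import Data.Bool using (Bool; true; false; _∧_; if_then_else_)
open import Data.Bool.Properties using (∧-zeroʳ)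
open import Data.Empty using (⊥-elim)
open import Agda.Builtin.Int using (pos)
open import Data.Integer using (ℤ; -_) renaming (_+_ to _+ℤ_; _*_ to _*ℤ_)
import Data.Integer.Properties as ℤ
import Data.Integer.Solver as ℤ-Solver
open import Data.List as List using (List; []; _∷_; _++_; map; concatMap; length; filter; applyUpTo; upTo; downFrom)
open import Data.List.Properties
  using (map-++; map-∘; map-cong; map-cong-local; map-applyUpTo; applyUpTo-∷ʳ; length-map; length-++; length-upTo;
         ++-identityʳ; filter-accept; filter-reject; filter-all; filter-none; filter-++; ∷-injective; ∷-injectiveˡ;
         ∷ʳ-injective; ∷ʳ-injectiveˡ; ≡-dec; reverse-upTo)
open import Data.List.Membership.Propositional using (find)
open import Data.List.Relation.Unary.All as All using (All; []; _∷_; all?)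
import Data.List.Relation.Unary.All.Properties as Allₚ
open import Data.List.Relation.Unary.AllPairs using ([]; _∷_)
open import Data.List.Relation.Unary.Linked as Linked using (Linked; []; [-]; _∷_)
import Data.List.Relation.Unary.Linked.Properties as Linkedₚ
open import Data.List.Relation.Unary.Unique.Propositional using (Unique)
open import Data.List.Relation.Binary.Permutation.Propositional using (_↭_; ↭-sym)
  renaming (refl to ↭-refl; prep to ↭-prep; swap to ↭-swap; trans to ↭-trans)
import Data.List.Relation.Binary.Permutation.Propositional.Properties as ↭
open import Data.List.Relation.Binary.Sublist.Propositional
  using (_⊆_; []; _∷_; _∷ʳ_; minimum; ⊆-refl; ⊆-trans; from∈)
open import Data.List.Relation.Binary.Sublist.Propositional.Properties using (All-resp-⊆; ++⁺ˡ)
open import Data.Nat using (ℕ; zero; suc; _+_; _∸_; _≤_; _<_; _≮_; z≤n; s≤s; _<?_; _≟_; _≡ᵇ_)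
open import Data.Nat.ListAction using (sum)
open import Data.Nat.ListAction.Properties using (sum-++)
import Data.Nat.Solver as ℕ-Solver
open import Data.Product using (Σ-syntax; _×_; _,_; proj₂)
open import Data.Sum using (inj₁; inj₂)
open import Function using (_∘_; case_of_)
open import Relation.Binary.Definitions using (tri<; tri≈; tri>)
open import Relation.Binary.PropositionalEquality
import Relation.Binary.Reasoning.Setoid as SetoidReasoning
open import Relation.Nullary using (¬_; does; yes; no)
open import Relation.Nullary.Decidable using (dec-true; dec-false; T?)
open import Relation.Unary using (Decidable)

∑ : {A : Set} → (A → ℕ) → List A → ℕ
∑ g xs = sum (map g xs)

𝟙 : Bool → ℕ
𝟙 true = 1
𝟙 false = 0

∑-++ : ∀ {A : Set} (g : A → ℕ) xs ys → ∑ g (xs ++ ys) ≡ ∑ g xs + ∑ g ys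
∑-++ g xs ys = trans (cong sum (map-++ g xs ys)) (sum-++ (map g xs) (map g ys))

∑-map : ∀ {A B : Set} (g : B → ℕ) (f : A → B) xs → ∑ g (map f xs) ≡ ∑ (g ∘ f) xs
∑-map g f xs = cong sum (sym (map-∘ {g = g} {f = f} xs))

∑-concatMap : ∀ {A B : Set} (g : B → ℕ) (f : A → List B) xs →
  ∑ g (concatMap f xs) ≡ ∑ (∑ g ∘ f) xs
∑-concatMap g f [] = refl
∑-concatMap g f (x ∷ xs) =
  trans (∑-++ g (f x) (concatMap f xs)) (cong (∑ g (f x) +_) (∑-concatMap g f xs))

∑-cong : ∀ {A : Set} {g h : A → ℕ} → (∀ x → g x ≡ h x) → ∀ xs → ∑ g xs ≡ ∑ h xs
∑-cong g≗h xs = cong sum (map-cong g≗h xs)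

∑-cong-All : ∀ {A : Set} {g h : A → ℕ} {xs} → All (λ x → g x ≡ h x) xs → ∑ g xs ≡ ∑ h xs
∑-cong-All g≡h = cong sum (map-cong-local g≡h)

∑-+ : ∀ {A : Set} (g h : A → ℕ) xs → ∑ (λ x → g x + h x) xs ≡ ∑ g xs + ∑ h xs
∑-+ g h [] = refl
∑-+ g h (x ∷ xs) =
  trans (cong (g x + h x +_) (∑-+ g h xs)) (interchange (g x) (h x) (∑ g xs) (∑ h xs))

length-filter≡∑ : ∀ {A : Set} {P : A → Set} (P? : Decidable P) xs →
  length (filter P? xs) ≡ ∑ (𝟙 ∘ does ∘ P?) xs
length-filter≡∑ P? [] = refl
length-filter≡∑ P? (x ∷ xs) with does (P? x)
... | true = cong suc (length-filter≡∑ P? xs)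
... | false = length-filter≡∑ P? xs

≗-by-list-induction : {A B : Set} (F G : List A → B) → F [] ≡ G [] →
  (∀ a as → F as ≡ G as → F (a ∷ as) ≡ G (a ∷ as)) → ∀ as → F as ≡ G as
≗-by-list-induction F G base step [] = base
≗-by-list-induction F G base step (a ∷ as) = step a as (≗-by-list-induction F G base step as)

-- Defs builds subseqs with a local copy of _++_ that cannot be named here: the meta in the type
-- of local-++≡++ is that local append, solved from its use below (the cons in the with-term is
-- qualified, since an ambiguous constructor there would not be abstracted).
mutual
  private
    local-++≡++ : ∀ k (x : ℕ) xs ws → _ ≡ ws ++ subseqs (suc k) xs
    local-++≡++ k x xs =
      ≗-by-list-induction _ (_++ subseqs (suc k) xs) refl (λ w _ → cong (w ∷_))

  subseqs-∷ : ∀ k x xs →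
    subseqs (suc k) (x ∷ xs) ≡ map (x ∷_) (subseqs k xs) ++ subseqs (suc k) xs
  subseqs-∷ k x xs with map (List._∷_ x) (subseqs k xs)
  ... | heads = local-++≡++ k x xs heads

countSub : (List ℕ → Bool) → ℕ → List ℕ → ℕ
countSub P k L = ∑ (𝟙 ∘ P) (subseqs k L)

countSub-zero : ∀ P L → countSub P 0 L ≡ 𝟙 (P [])
countSub-zero P L = +-identityʳ (𝟙 (P []))

countSub-∷ : ∀ P k x L →
  countSub P (suc k) (x ∷ L) ≡ countSub (P ∘ (x ∷_)) k L + countSub P (suc k) L
countSub-∷ P k x L = begin
  ∑ (𝟙 ∘ P) (subseqs (suc k) (x ∷ L))
    ≡⟨ cong (∑ (𝟙 ∘ P)) (subseqs-∷ k x L) ⟩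
  ∑ (𝟙 ∘ P) (map (x ∷_) (subseqs k L) ++ subseqs (suc k) L)
    ≡⟨ ∑-++ (𝟙 ∘ P) (map (x ∷_) (subseqs k L)) (subseqs (suc k) L) ⟩
  ∑ (𝟙 ∘ P) (map (x ∷_) (subseqs k L)) + countSub P (suc k) L
    ≡⟨ cong (_+ countSub P (suc k) L) (∑-map (𝟙 ∘ P) (x ∷_) (subseqs k L)) ⟩
  countSub (P ∘ (x ∷_)) k L + countSub P (suc k) L ∎
  where open ≡-Reasoning

countSub-cong : ∀ {P Q} k L → (∀ {s} → s ⊆ L → P s ≡ Q s) → countSub P k L ≡ countSub Q k L
countSub-cong {P} {Q} zero L P≡Q =
  trans (countSub-zero P L) (trans (cong 𝟙 (P≡Q (minimum L))) (sym (countSub-zero Q L)))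
countSub-cong (suc k) [] P≡Q = refl
countSub-cong {P} {Q} (suc k) (x ∷ L) P≡Q =
  trans (countSub-∷ P k x L)
    (trans (cong₂ _+_ (countSub-cong k L (λ s⊆L → P≡Q (refl ∷ s⊆L)))
                      (countSub-cong (suc k) L (λ s⊆L → P≡Q (x ∷ʳ s⊆L))))
           (sym (countSub-∷ Q k x L)))

countSub-none : ∀ {P} k L → (∀ {s} → s ⊆ L → P s ≡ false) → countSub P k L ≡ 0
countSub-none {P} zero L P≡false = trans (countSub-zero P L) (cong 𝟙 (P≡false (minimum L)))
countSub-none (suc k) [] P≡false = refl
countSub-none {P} (suc k) (x ∷ L) P≡false =
  trans (countSub-∷ P k x L)
    (cong₂ _+_ (countSub-none k L (λ s⊆L → P≡false (refl ∷ s⊆L)))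
               (countSub-none (suc k) L (λ s⊆L → P≡false (x ∷ʳ s⊆L))))

countSub-∷-≥ʰ : ∀ P k x L → countSub (P ∘ (x ∷_)) k L ≤ countSub P (suc k) (x ∷ L)
countSub-∷-≥ʰ P k x L =
  subst (countSub (P ∘ (x ∷_)) k L ≤_) (sym (countSub-∷ P k x L)) (m≤m+n _ (countSub P (suc k) L))

countSub-∷-≥ᵗ : ∀ P k x L → countSub P (suc k) L ≤ countSub P (suc k) (x ∷ L)
countSub-∷-≥ᵗ P k x L =
  subst (countSub P (suc k) L ≤_) (sym (countSub-∷ P k x L)) (m≤n+m _ (countSub (P ∘ (x ∷_)) k L))

countSub-pos : ∀ {P s L} → s ⊆ L → P s ≡ true → 1 ≤ countSub P (length s) L
countSub-pos {P} {[]} {L} _ Ps = subst (1 ≤_) (sym (trans (countSub-zero P L) (cong 𝟙 Ps))) ≤-refl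
countSub-pos {P} {a ∷ s} {x ∷ L} (x ∷ʳ s⊆L) Ps =
  ≤-trans (countSub-pos s⊆L Ps) (countSub-∷-≥ᵗ P (length s) x L)
countSub-pos {P} {a ∷ s} {a ∷ L} (refl ∷ s⊆L) Ps =
  ≤-trans (countSub-pos {P ∘ (a ∷_)} s⊆L Ps) (countSub-∷-≥ʰ P (length s) a L)

countSub-two : ∀ {P s t L} → s ⊆ L → t ⊆ L → length s ≡ length t → s ≢ t →
  P s ≡ true → P t ≡ true → 2 ≤ countSub P (length s) L
countSub-two {s = []} {[]} _ _ _ s≢t _ _ = ⊥-elim (s≢t refl)
countSub-two {P} {a ∷ s} {b ∷ t} {x ∷ L} (x ∷ʳ s⊆L) (x ∷ʳ t⊆L) len s≢t Ps Pt =
  ≤-trans (countSub-two s⊆L t⊆L len s≢t Ps Pt) (countSub-∷-≥ᵗ P (length s) x L)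
countSub-two {P} {a ∷ s} {b ∷ t} {a ∷ L} (refl ∷ s⊆L) (a ∷ʳ t⊆L) len _ Ps Pt =
  subst (2 ≤_) (sym (countSub-∷ P (length s) a L))
    (+-mono-≤ (countSub-pos {P ∘ (a ∷_)} s⊆L Ps)
              (subst (λ k → 1 ≤ countSub P k L) (sym len) (countSub-pos t⊆L Pt)))
countSub-two {P} {a ∷ s} {b ∷ t} {b ∷ L} (b ∷ʳ s⊆L) (refl ∷ t⊆L) len _ Ps Pt =
  subst (2 ≤_) (sym (countSub-∷ P (length s) b L))
    (+-mono-≤ (subst (λ k → 1 ≤ countSub (P ∘ (b ∷_)) k L) (sym (suc-injective len))
                     (countSub-pos {P ∘ (b ∷_)} t⊆L Pt))
              (countSub-pos s⊆L Ps))
countSub-two {P} {a ∷ s} {a ∷ t} {a ∷ L} (refl ∷ s⊆L) (refl ∷ t⊆L) len s≢t Ps Pt =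
  ≤-trans (countSub-two {P ∘ (a ∷_)} s⊆L t⊆L (suc-injective len) (s≢t ∘ cong (a ∷_)) Ps Pt)
    (countSub-∷-≥ʰ P (length s) a L)

countSub-witness : ∀ P k L → 1 ≤ countSub P k L → Σ[ s ∈ List ℕ ] s ⊆ L × length s ≡ k × P s ≡ true
countSub-witness P zero L count≥1 with P [] in Ps
... | true = [] , minimum L , refl , Ps
... | false = ⊥-elim (1+n≰n count≥1)
countSub-witness P (suc k) (x ∷ L) count≥1 with countSub (P ∘ (x ∷_)) k L in headed
... | suc _ with countSub-witness (P ∘ (x ∷_)) k L (subst (1 ≤_) (sym headed) (s≤s z≤n))
...   | s , s⊆L , refl , Ps = x ∷ s , refl ∷ s⊆L , refl , Ps
countSub-witness P (suc k) (x ∷ L) count≥1 | zero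
  with countSub-witness P (suc k) L (subst (1 ≤_) (trans (countSub-∷ P k x L) (cong (_+ _) headed)) count≥1)
... | s , s⊆L , len , Ps = s , x ∷ʳ s⊆L , len , Ps

-- The length-k subsequences of α ++ y ∷ β that contain this occurrence of y.
countThrough : (List ℕ → Bool) → ℕ → List ℕ → ℕ → List ℕ → ℕ
countThrough P zero α y β = 0
countThrough P (suc k) [] y β = countSub (P ∘ (y ∷_)) k β
countThrough P (suc k) (a ∷ α) y β = countThrough (P ∘ (a ∷_)) k α y β + countThrough P (suc k) α y β

countSub-insert : ∀ P k α y β →
  countSub P k (α ++ y ∷ β) ≡ countSub P k (α ++ β) + countThrough P k α y β
countSub-insert P zero α y β =
  trans (countSub-zero P (α ++ y ∷ β))
        (sym (trans (+-identityʳ _) (countSub-zero P (α ++ β))))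
countSub-insert P (suc k) [] y β =
  trans (countSub-∷ P k y β) (+-comm (countSub (P ∘ (y ∷_)) k β) (countSub P (suc k) β))
countSub-insert P (suc k) (a ∷ α) y β = begin
  countSub P (suc k) (a ∷ α ++ y ∷ β)
    ≡⟨ countSub-∷ P k a (α ++ y ∷ β) ⟩
  countSub (P ∘ (a ∷_)) k (α ++ y ∷ β) + countSub P (suc k) (α ++ y ∷ β)
    ≡⟨ cong₂ _+_ (countSub-insert (P ∘ (a ∷_)) k α y β) (countSub-insert P (suc k) α y β) ⟩
  (countSub (P ∘ (a ∷_)) k (α ++ β) + countThrough (P ∘ (a ∷_)) k α y β) +
  (countSub P (suc k) (α ++ β) + countThrough P (suc k) α y β)
    ≡⟨ interchange (countSub (P ∘ (a ∷_)) k (α ++ β)) (countThrough (P ∘ (a ∷_)) k α y β) _ _ ⟩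
  (countSub (P ∘ (a ∷_)) k (α ++ β) + countSub P (suc k) (α ++ β)) +
  (countThrough (P ∘ (a ∷_)) k α y β + countThrough P (suc k) α y β)
    ≡⟨ cong (_+ countThrough P (suc k) (a ∷ α) y β) (countSub-∷ P k a (α ++ β)) ⟨
  countSub P (suc k) (a ∷ α ++ β) + countThrough P (suc k) (a ∷ α) y β ∎
  where open ≡-Reasoning

countThrough-none : ∀ {P} k α y β →
  (∀ {s₁ s₂} → s₁ ⊆ α → s₂ ⊆ β → P (s₁ ++ y ∷ s₂) ≡ false) → countThrough P k α y β ≡ 0
countThrough-none zero α y β _ = refl
countThrough-none (suc k) [] y β P≡false = countSub-none k β (P≡false [])
countThrough-none (suc k) (a ∷ α) y β P≡false =
  cong₂ _+_ (countThrough-none k α y β (λ s₁⊆α → P≡false (refl ∷ s₁⊆α)))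
            (countThrough-none (suc k) α y β (λ s₁⊆α → P≡false (a ∷ʳ s₁⊆α)))

countSub-insert-unused : ∀ {P} k α y β →
  (∀ {s₁ s₂} → s₁ ⊆ α → s₂ ⊆ β → P (s₁ ++ y ∷ s₂) ≡ false) →
  countSub P k (α ++ y ∷ β) ≡ countSub P k (α ++ β)
countSub-insert-unused {P} k α y β P≡false = begin
  countSub P k (α ++ y ∷ β)                              ≡⟨ countSub-insert P k α y β ⟩
  countSub P k (α ++ β) + countThrough P k α y β         ≡⟨ cong (_ +_) (countThrough-none k α y β P≡false) ⟩
  countSub P k (α ++ β) + 0                              ≡⟨ +-identityʳ _ ⟩
  countSub P k (α ++ β)                                  ∎
  where open ≡-Reasoning

countThrough-last : ∀ P k α y → countThrough P (suc k) α y [] ≡ countSub (λ s → P (s ++ y ∷ [])) k α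
countThrough-last P zero [] y = refl
countThrough-last P (suc k) [] y = refl
countThrough-last P zero (a ∷ α) y = countThrough-last P zero α y
countThrough-last P (suc k) (a ∷ α) y =
  trans (cong₂ _+_ (countThrough-last (P ∘ (a ∷_)) k α y) (countThrough-last P (suc k) α y))
        (sym (countSub-∷ (λ s → P (s ++ y ∷ [])) k a α))

∑-insertions-last : ∀ (g : List ℕ → ℕ) y r →
  (∀ α b β → r ≡ α ++ b ∷ β → g (α ++ y ∷ b ∷ β) ≡ 0) → ∑ g (insertions y r) ≡ g (r ++ y ∷ [])
∑-insertions-last g y [] _ = +-identityʳ (g (y ∷ []))
∑-insertions-last g y (z ∷ r) g≡0 = cong₂ _+_ (g≡0 [] z r refl) (begin
  ∑ g (map (z ∷_) (insertions y r))  ≡⟨ ∑-map g (z ∷_) (insertions y r) ⟩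
  ∑ (g ∘ (z ∷_)) (insertions y r)    ≡⟨ ∑-insertions-last (g ∘ (z ∷_)) y r
                                          (λ α b β r≡ → g≡0 (z ∷ α) b β (cong (z ∷_) r≡)) ⟩
  g (z ∷ r ++ y ∷ [])                ∎)
  where open ≡-Reasoning

∑-insertions² : (List ℕ → ℕ) → ℕ → ℕ → List ℕ → ℕ
∑-insertions² g x y σ = ∑ (λ τ → ∑ g (insertions x τ)) (insertions y σ)

∑-insertions²-∷ : ∀ g x y z σ → ∑-insertions² g x y (z ∷ σ) ≡
  g (x ∷ y ∷ z ∷ σ) + (g (y ∷ x ∷ z ∷ σ) + ∑ (λ t → g (y ∷ z ∷ t)) (insertions x σ))
  + (∑ (λ τ → g (x ∷ z ∷ τ)) (insertions y σ) + ∑-insertions² (g ∘ (z ∷_)) x y σ)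
∑-insertions²-∷ g x y z σ = cong₂ _+_
  (cong (g (x ∷ y ∷ z ∷ σ) +_)
    (trans (∑-map g (y ∷_) (insertions x (z ∷ σ)))
           (cong (g (y ∷ x ∷ z ∷ σ) +_) (∑-map (g ∘ (y ∷_)) (z ∷_) (insertions x σ)))))
  (trans (∑-map _ (z ∷_) (insertions y σ))
    (trans (∑-cong (λ τ → cong (g (x ∷ z ∷ τ) +_) (∑-map g (z ∷_) (insertions x τ))) (insertions y σ))
           (∑-+ _ _ (insertions y σ))))

∑-insertions²-comm : ∀ g x y σ → ∑-insertions² g x y σ ≡ ∑-insertions² g y x σ
∑-insertions²-comm g x y [] =
  cong (_+ 0) (solve 2 (λ a b → a :+ (b :+ con 0) := b :+ (a :+ con 0)) refl (g (x ∷ y ∷ [])) (g (y ∷ x ∷ [])))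
  where open ℕ-Solver.+-*-Solver
∑-insertions²-comm g x y (z ∷ σ)
  rewrite ∑-insertions²-∷ g x y z σ | ∑-insertions²-∷ g y x z σ
        | ∑-insertions²-comm (g ∘ (z ∷_)) x y σ =
  solve 5 (λ a b c d e → a :+ (b :+ c) :+ (d :+ e) := b :+ (a :+ d) :+ (c :+ e)) refl
    (g (x ∷ y ∷ z ∷ σ)) (g (y ∷ x ∷ z ∷ σ)) (∑ (λ t → g (y ∷ z ∷ t)) (insertions x σ))
    (∑ (λ τ → g (x ∷ z ∷ τ)) (insertions y σ)) (∑-insertions² (g ∘ (z ∷_)) y x σ)
  where open ℕ-Solver.+-*-Solver

∑-perms-↭ : ∀ {xs ys} → xs ↭ ys → ∀ (g : List ℕ → ℕ) → ∑ g (perms xs) ≡ ∑ g (perms ys)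
∑-perms-↭ ↭-refl g = refl
∑-perms-↭ {x ∷ xs} {x ∷ ys} (↭-prep x p) g = begin
  ∑ g (perms (x ∷ xs))                  ≡⟨ ∑-concatMap g (insertions x) (perms xs) ⟩
  ∑ (∑ g ∘ insertions x) (perms xs)     ≡⟨ ∑-perms-↭ p _ ⟩
  ∑ (∑ g ∘ insertions x) (perms ys)     ≡⟨ ∑-concatMap g (insertions x) (perms ys) ⟨
  ∑ g (perms (x ∷ ys))                  ∎
  where open ≡-Reasoning
∑-perms-↭ {x ∷ y ∷ xs} {y ∷ x ∷ ys} (↭-swap x y p) g = begin
  ∑ g (perms (x ∷ y ∷ xs))                 ≡⟨ ∑-concatMap g (insertions x) (perms (y ∷ xs)) ⟩
  ∑ (∑ g ∘ insertions x) (perms (y ∷ xs))  ≡⟨ ∑-concatMap _ (insertions y) (perms xs) ⟩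
  ∑ (∑-insertions² g x y) (perms xs)       ≡⟨ ∑-cong (∑-insertions²-comm g x y) (perms xs) ⟩
  ∑ (∑-insertions² g y x) (perms xs)       ≡⟨ ∑-perms-↭ p _ ⟩
  ∑ (∑-insertions² g y x) (perms ys)       ≡⟨ ∑-concatMap _ (insertions x) (perms ys) ⟨
  ∑ (∑ g ∘ insertions y) (perms (x ∷ ys))  ≡⟨ ∑-concatMap g (insertions y) (perms (x ∷ ys)) ⟨
  ∑ g (perms (y ∷ x ∷ ys))                 ∎
  where open ≡-Reasoning
∑-perms-↭ (↭-trans p q) g = trans (∑-perms-↭ p g) (∑-perms-↭ q g)

-- Standardization

rank : List ℕ → ℕ → ℕ
rank L x = suc (countLess x L)

countLess-< : ∀ {x y} ys → y < x → countLess x (y ∷ ys) ≡ suc (countLess x ys)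
countLess-< {x} ys y<x = cong length (filter-accept (_<? x) y<x)

countLess-≮ : ∀ {x y} ys → y ≮ x → countLess x (y ∷ ys) ≡ countLess x ys
countLess-≮ {x} ys y≮x = cong length (filter-reject (_<? x) y≮x)

countLess-++ : ∀ x xs ys → countLess x (xs ++ ys) ≡ countLess x xs + countLess x ys
countLess-++ x xs ys = trans (cong length (filter-++ (_<? x) xs ys)) (length-++ (filter (_<? x) xs))

countLess-all : ∀ {x ys} → All (_< x) ys → countLess x ys ≡ length ys
countLess-all {x} ys<x = cong length (filter-all (_<? x) ys<x)

countLess-none : ∀ {x ys} → All (_≮ x) ys → countLess x ys ≡ 0
countLess-none {x} ys≮x = cong length (filter-none (_<? x) ys≮x)

countLess-mono : ∀ {x z} ys → x ≤ z → countLess x ys ≤ countLess z ys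
countLess-mono [] _ = z≤n
countLess-mono {x} {z} (y ∷ ys) x≤z with y <? x | y <? z
... | yes y<x | _ =
  subst₂ _≤_ (sym (countLess-< ys y<x)) (sym (countLess-< ys (<-≤-trans y<x x≤z))) (s≤s (countLess-mono ys x≤z))
... | no y≮x | yes y<z =
  subst₂ _≤_ (sym (countLess-≮ ys y≮x)) (sym (countLess-< ys y<z)) (m≤n⇒m≤1+n (countLess-mono ys x≤z))
... | no y≮x | no y≮z =
  subst₂ _≤_ (sym (countLess-≮ ys y≮x)) (sym (countLess-≮ ys y≮z)) (countLess-mono ys x≤z)

rank-reflects-< : ∀ L {a b} → rank L a < rank L b → a < b
rank-reflects-< L {a} {b} ra<rb with a <? b
... | yes a<b = a<b
... | no a≮b = ⊥-elim (<⇒≱ ra<rb (s≤s (countLess-mono L (≮⇒≥ a≮b))))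

countLess-insert-≮ : ∀ {x y} α β → y ≮ x → countLess x (α ++ y ∷ β) ≡ countLess x (α ++ β)
countLess-insert-≮ {x} α β y≮x = begin
  countLess x (α ++ _ ∷ β)             ≡⟨ countLess-++ x α (_ ∷ β) ⟩
  countLess x α + countLess x (_ ∷ β)  ≡⟨ cong (countLess x α +_) (countLess-≮ β y≮x) ⟩
  countLess x α + countLess x β        ≡⟨ countLess-++ x α β ⟨
  countLess x (α ++ β)                 ∎
  where open ≡-Reasoning

countLess-insert-< : ∀ {x y} α β → y < x → countLess x (α ++ y ∷ β) ≡ suc (countLess x (α ++ β))
countLess-insert-< {x} α β y<x = begin
  countLess x (α ++ _ ∷ β)             ≡⟨ countLess-++ x α (_ ∷ β) ⟩
  countLess x α + countLess x (_ ∷ β)  ≡⟨ cong (countLess x α +_) (countLess-< β y<x) ⟩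
  countLess x α + suc (countLess x β)  ≡⟨ +-suc (countLess x α) (countLess x β) ⟩
  suc (countLess x α + countLess x β)  ≡⟨ cong suc (countLess-++ x α β) ⟨
  suc (countLess x (α ++ β))           ∎
  where open ≡-Reasoning

standardize-insert-max : ∀ α β {y} → All (_< y) α → All (_< y) β →
  standardize (α ++ y ∷ β) ≡ map (rank (α ++ β)) α ++ suc (length (α ++ β)) ∷ map (rank (α ++ β)) β
standardize-insert-max α β {y} α<y β<y =
  trans (map-++ (rank (α ++ y ∷ β)) α (y ∷ β))
        (cong₂ _++_ (ranks-unchanged α<y) (cong₂ _∷_ rank-y (ranks-unchanged β<y)))
  where
  ranks-unchanged : ∀ {γ} → All (_< y) γ → map (rank (α ++ y ∷ β)) γ ≡ map (rank (α ++ β)) γ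
  ranks-unchanged = map-cong-local ∘ All.map (λ x<y → cong suc (countLess-insert-≮ α β (<-asym x<y)))
  rank-y : rank (α ++ y ∷ β) y ≡ suc (length (α ++ β))
  rank-y = cong suc (trans (countLess-insert-≮ α β (<-irrefl refl)) (countLess-all (Allₚ.++⁺ α<y β<y)))

standardize-insert-min : ∀ α β {m} → All (m <_) α → All (m <_) β →
  standardize (α ++ m ∷ β) ≡ map (suc ∘ rank (α ++ β)) α ++ 1 ∷ map (suc ∘ rank (α ++ β)) β
standardize-insert-min α β {m} m<α m<β =
  trans (map-++ (rank (α ++ m ∷ β)) α (m ∷ β))
        (cong₂ _++_ (ranks-shifted m<α) (cong₂ _∷_ rank-m (ranks-shifted m<β)))
  where
  ranks-shifted : ∀ {γ} → All (m <_) γ → map (rank (α ++ m ∷ β)) γ ≡ map (suc ∘ rank (α ++ β)) γ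
  ranks-shifted = map-cong-local ∘ All.map (cong suc ∘ countLess-insert-< α β)
  rank-m : rank (α ++ m ∷ β) m ≡ 1
  rank-m = cong suc (trans (countLess-insert-≮ α β (<-irrefl refl))
                           (countLess-none (All.map <-asym (Allₚ.++⁺ m<α m<β))))

standardize-max-∷ : ∀ {y} s → All (_< y) s → standardize (y ∷ s) ≡ suc (length s) ∷ standardize s
standardize-max-∷ s s<y = standardize-insert-max [] s [] s<y

standardize-∷ʳ-max : ∀ {y} s → All (_< y) s →
  standardize (s ++ y ∷ []) ≡ standardize s ++ suc (length s) ∷ []
standardize-∷ʳ-max s s<y =
  trans (standardize-insert-max s [] s<y []) (cong (λ L → map (rank L) s ++ suc (length L) ∷ []) (++-identityʳ s))

standardize-min-∷ : ∀ {m} s → All (m <_) s → standardize (m ∷ s) ≡ 1 ∷ map suc (standardize s)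
standardize-min-∷ s m<s = trans (standardize-insert-min [] s [] m<s) (cong (1 ∷_) (map-∘ s))

standardize-∷ʳ-min : ∀ {m} s → All (m <_) s → standardize (s ++ m ∷ []) ≡ map suc (standardize s) ++ 1 ∷ []
standardize-∷ʳ-min s m<s =
  trans (standardize-insert-min s [] m<s [])
        (cong (_++ 1 ∷ []) (trans (cong (λ L → map (suc ∘ rank L) s) (++-identityʳ s)) (map-∘ s)))

standardize-[_] : ∀ x → standardize (x ∷ []) ≡ 1 ∷ []
standardize-[ x ] = standardize-min-∷ {x} [] []

standardize-second-max : ∀ {s₀ y} s → All (_< s₀) s → s₀ < y →
  standardize (s₀ ∷ y ∷ s) ≡ suc (length s) ∷ suc (suc (length s)) ∷ map (rank (s₀ ∷ s)) s
standardize-second-max {s₀} s s<s₀ s₀<y =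
  trans (standardize-insert-max (s₀ ∷ []) s (s₀<y ∷ []) (All.map (λ x<s₀ → <-trans x<s₀ s₀<y) s<s₀))
        (cong (λ r → r ∷ suc (suc (length s)) ∷ map (rank (s₀ ∷ s)) s)
              (cong suc (trans (countLess-≮ s (<-irrefl refl)) (countLess-all s<s₀))))

length-standardize : ∀ s → length (standardize s) ≡ length s
length-standardize s = length-map _ s

oneTo-suc : ∀ m → oneTo (suc m) ≡ 1 ∷ map suc (oneTo m)
oneTo-suc m = cong (λ xs → 1 ∷ map suc xs) (sym (map-applyUpTo (λ x → x) suc m))

oneTo-∷ʳ : ∀ m → oneTo (suc m) ≡ oneTo m ++ suc m ∷ []
oneTo-∷ʳ m =
  trans (cong (map suc) (sym (applyUpTo-∷ʳ (λ x → x) m))) (map-++ suc (applyUpTo (λ x → x) m) (m ∷ []))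

length-oneTo : ∀ m → length (oneTo m) ≡ m
length-oneTo m = trans (length-map suc (applyUpTo (λ x → x) m)) (length-upTo m)

oneTo-increasing : ∀ m → Linked _<_ (oneTo m)
oneTo-increasing zero = []
oneTo-increasing (suc zero) = [-]
oneTo-increasing (suc (suc m)) =
  subst (Linked _<_) (sym (oneTo-suc (suc m)))
        (s≤s (s≤s z≤n) ∷ Linkedₚ.map⁺ (Linked.map s≤s (oneTo-increasing (suc m))))

increasing⇒head< : ∀ {a s} → Linked _<_ (a ∷ s) → All (a <_) s
increasing⇒head< [-] = []
increasing⇒head< (a<b ∷ inc) = Linkedₚ.Linked⇒All <-trans a<b inc

increasing-drop-second : ∀ {a b s} → Linked _<_ (a ∷ b ∷ s) → Linked _<_ (a ∷ s)
increasing-drop-second (_ ∷ [-]) = [-]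
increasing-drop-second (a<b ∷ b<c ∷ inc) = <-trans a<b b<c ∷ inc

standardize-increasing : ∀ {s} → Linked _<_ s → standardize s ≡ oneTo (length s)
standardize-increasing {[]} [] = refl
standardize-increasing {a ∷ s} inc = begin
  standardize (a ∷ s)               ≡⟨ standardize-min-∷ s (increasing⇒head< inc) ⟩
  1 ∷ map suc (standardize s)       ≡⟨ cong (λ t → 1 ∷ map suc t) (standardize-increasing (Linked.tail inc)) ⟩
  1 ∷ map suc (oneTo (length s))    ≡⟨ oneTo-suc (length s) ⟨
  oneTo (length (a ∷ s))            ∎
  where open ≡-Reasoning

-- oneTo m is increasing, and rank s reflects the order of s.
standardize-oneTo⇒increasing : ∀ {s m} → standardize s ≡ oneTo m → Linked _<_ s
standardize-oneTo⇒increasing {s} std≡ =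
  Linked.map (rank-reflects-< s) (Linkedₚ.map⁻ (subst (Linked _<_) (sym std≡) (oneTo-increasing _)))

matches : List ℕ → List ℕ → Bool
matches τ s = does (≡-dec _≟_ (standardize s) τ)

occurrences≡countSub : ∀ τ π → occurrences τ π ≡ countSub (matches τ) (length τ) π
occurrences≡countSub τ π = length-filter≡∑ (λ s → ≡-dec _≟_ (standardize s) τ) (subseqs (length τ) π)

matches-true : ∀ {τ s} → standardize s ≡ τ → matches τ s ≡ true
matches-true = dec-true (≡-dec _≟_ _ _)

matches-false : ∀ {τ s} → standardize s ≢ τ → matches τ s ≡ false
matches-false = dec-false (≡-dec _≟_ _ _)

matches-sound : ∀ {τ s} → matches τ s ≡ true → standardize s ≡ τ
matches-sound {τ} {s} m with ≡-dec _≟_ (standardize s) τ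
... | yes std≡τ = std≡τ

matches-⇔ : ∀ {τ s τ′ s′} → (standardize s ≡ τ → standardize s′ ≡ τ′) →
  (standardize s′ ≡ τ′ → standardize s ≡ τ) → matches τ s ≡ matches τ′ s′
matches-⇔ {τ} {s} to from with ≡-dec _≟_ (standardize s) τ
... | yes std≡τ = sym (matches-true (to std≡τ))
... | no std≢τ = sym (matches-false (std≢τ ∘ from))

-- In a subsequence through a new maximum y the largest rank sits at the position of y, so a
-- pattern can only be matched there if its own maximum sits at that position.
matches-max-∷ : ∀ {t τ y s} → All (_< y) s → t ≢ suc (length τ) → matches (t ∷ τ) (y ∷ s) ≡ false
matches-max-∷ {s = s} s<y t≢ = matches-false λ std≡ →
  let t≡ , τ≡ = ∷-injective (trans (sym (standardize-max-∷ s s<y)) std≡)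
  in t≢ (trans (sym t≡) (cong suc (trans (sym (length-standardize s)) (cong length τ≡))))

matches-second-max : ∀ {t₀ t₁ τ s₀ y s} → All (_< s₀) s → s₀ < y →
  ¬ (t₀ ≡ suc (length τ) × t₁ ≡ suc (suc (length τ))) → matches (t₀ ∷ t₁ ∷ τ) (s₀ ∷ y ∷ s) ≡ false
matches-second-max {s = s} s<s₀ s₀<y t≢ = matches-false λ std≡ →
  let t₀≡ , rest≡ = ∷-injective (trans (sym (standardize-second-max s s<s₀ s₀<y)) std≡)
      t₁≡ , τ≡ = ∷-injective rest≡
      |s|≡|τ| = trans (sym (length-map _ s)) (cong length τ≡)
  in t≢ (trans (sym t₀≡) (cong suc |s|≡|τ|) , trans (sym t₁≡) (cong (suc ∘ suc) |s|≡|τ|))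

matches-∷ʳ-max : ∀ {τ t y s} → All (_< y) s → t ≢ suc (length τ) →
  matches (τ ++ t ∷ []) (s ++ y ∷ []) ≡ false
matches-∷ʳ-max {τ} {s = s} s<y t≢ = matches-false λ std≡ →
  let std≡τ , t≡ = ∷ʳ-injective (standardize s) τ (trans (sym (standardize-∷ʳ-max s s<y)) std≡)
  in t≢ (trans (sym t≡) (cong suc (trans (sym (length-standardize s)) (cong length std≡τ))))

countSub-matches-max-∷ : ∀ {t τ y σ} → All (_< y) σ → t ≢ suc (length τ) → ∀ k →
  countSub (matches (t ∷ τ)) k (y ∷ σ) ≡ countSub (matches (t ∷ τ)) k σ
countSub-matches-max-∷ {y = y} {σ} σ<y t≢ k =
  countSub-insert-unused k [] y σ λ { [] s⊆σ → matches-max-∷ (All-resp-⊆ s⊆σ σ<y) t≢ }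

countSub-matches-second-max : ∀ {t₀ t₁ τ s₀ y σ} → All (_< s₀) σ → s₀ < y →
  t₀ ≢ suc (suc (length τ)) → ¬ (t₀ ≡ suc (length τ) × t₁ ≡ suc (suc (length τ))) → ∀ k →
  countSub (matches (t₀ ∷ t₁ ∷ τ)) k (s₀ ∷ y ∷ σ) ≡ countSub (matches (t₀ ∷ t₁ ∷ τ)) k (s₀ ∷ σ)
countSub-matches-second-max {s₀ = s₀} {y} {σ} σ<s₀ s₀<y t₀≢ t≢ k =
  countSub-insert-unused k (s₀ ∷ []) y σ λ where
    (s₀ ∷ʳ []) s⊆σ →
      matches-max-∷ (All.map (λ x<s₀ → <-trans x<s₀ s₀<y) (All-resp-⊆ s⊆σ σ<s₀)) t₀≢
    (refl ∷ []) s⊆σ → matches-second-max (All-resp-⊆ s⊆σ σ<s₀) s₀<y t≢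

countSub-matches-∷ʳ-max : ∀ {τ t y σ} → All (_< y) σ → t ≢ suc (length τ) → ∀ k →
  countSub (matches (τ ++ t ∷ [])) k (σ ++ y ∷ []) ≡ countSub (matches (τ ++ t ∷ [])) k σ
countSub-matches-∷ʳ-max {y = y} {σ} σ<y t≢ k =
  trans (countSub-insert-unused k σ y [] λ { s⊆σ [] → matches-∷ʳ-max (All-resp-⊆ s⊆σ σ<y) t≢ })
        (cong (countSub _ k) (++-identityʳ σ))

-- Permutations in P(132)

inP132-resp : ∀ {π π′} →
  (∀ k → countSub (matches (1 ∷ 3 ∷ 2 ∷ [])) k π ≡ countSub (matches (1 ∷ 3 ∷ 2 ∷ [])) k π′) →
  (∀ k → countSub (matches (2 ∷ 3 ∷ 4 ∷ 1 ∷ [])) k π ≡ countSub (matches (2 ∷ 3 ∷ 4 ∷ 1 ∷ [])) k π′) →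
  (∀ k → countSub (matches (3 ∷ 2 ∷ 4 ∷ 1 ∷ [])) k π ≡ countSub (matches (3 ∷ 2 ∷ 4 ∷ 1 ∷ [])) k π′) →
  inP132 π ≡ inP132 π′
inP132-resp {π} {π′} e₁ e₂ e₃ =
  cong₂ _∧_ (avoids-resp (1 ∷ 3 ∷ 2 ∷ []) (e₁ 3))
    (cong₂ _∧_ (avoids-resp (2 ∷ 3 ∷ 4 ∷ 1 ∷ []) (e₂ 4)) (avoids-resp (3 ∷ 2 ∷ 4 ∷ 1 ∷ []) (e₃ 4)))
  where
  avoids-resp : ∀ τ → countSub (matches τ) (length τ) π ≡ countSub (matches τ) (length τ) π′ →
    avoids π τ ≡ avoids π′ τ
  avoids-resp τ e =
    cong (_≡ᵇ 0) (trans (occurrences≡countSub τ π) (trans e (sym (occurrences≡countSub τ π′))))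

inP132-max-∷ : ∀ {y σ} → All (_< y) σ → inP132 (y ∷ σ) ≡ inP132 σ
inP132-max-∷ σ<y = inP132-resp (countSub-matches-max-∷ σ<y (λ ()))
                                (countSub-matches-max-∷ σ<y (λ ()))
                                (countSub-matches-max-∷ σ<y (λ ()))

inP132-second-max : ∀ {s₀ y σ} → All (_< s₀) σ → s₀ < y → inP132 (s₀ ∷ y ∷ σ) ≡ inP132 (s₀ ∷ σ)
inP132-second-max σ<s₀ s₀<y =
  inP132-resp (countSub-matches-second-max σ<s₀ s₀<y (λ ()) (λ { (() , _) }))
              (countSub-matches-second-max σ<s₀ s₀<y (λ ()) (λ { (() , _) }))
              (countSub-matches-second-max σ<s₀ s₀<y (λ ()) (λ { (_ , ()) }))

inP132-∷ʳ-max : ∀ {y σ} → All (_< y) σ → inP132 (σ ++ y ∷ []) ≡ inP132 σ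
inP132-∷ʳ-max σ<y = inP132-resp (countSub-matches-∷ʳ-max {τ = 1 ∷ 3 ∷ []} σ<y (λ ()))
                                (countSub-matches-∷ʳ-max {τ = 2 ∷ 3 ∷ 4 ∷ []} σ<y (λ ()))
                                (countSub-matches-∷ʳ-max {τ = 3 ∷ 2 ∷ 4 ∷ []} σ<y (λ ()))

avoids-contains : ∀ {s π τ} → s ⊆ π → standardize s ≡ τ → avoids π τ ≡ false
avoids-contains {s} {π} {τ} s⊆π std≡τ = positive⇒≢0 (begin
  1                                       ≤⟨ countSub-pos s⊆π (matches-true std≡τ) ⟩
  countSub (matches τ) (length s) π       ≡⟨ cong (λ k → countSub (matches τ) k π) |s|≡|τ| ⟩
  countSub (matches τ) (length τ) π       ≡⟨ occurrences≡countSub τ π ⟨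
  occurrences τ π                         ∎)
  where
  open ≤-Reasoning
  |s|≡|τ| = trans (sym (length-standardize s)) (cong length std≡τ)
  positive⇒≢0 : ∀ {n} → 1 ≤ n → (n ≡ᵇ 0) ≡ false
  positive⇒≢0 (s≤s _) = refl

contains-132 : ∀ {s π} → s ⊆ π → standardize s ≡ 1 ∷ 3 ∷ 2 ∷ [] → inP132 π ≡ false
contains-132 {π = π} s⊆π std≡ =
  cong (_∧ (avoids π (2 ∷ 3 ∷ 4 ∷ 1 ∷ []) ∧ avoids π (3 ∷ 2 ∷ 4 ∷ 1 ∷ []))) (avoids-contains s⊆π std≡)

contains-2341 : ∀ {s π} → s ⊆ π → standardize s ≡ 2 ∷ 3 ∷ 4 ∷ 1 ∷ [] → inP132 π ≡ false
contains-2341 {π = π} s⊆π std≡ =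
  trans (cong (λ b → avoids π (1 ∷ 3 ∷ 2 ∷ []) ∧ (b ∧ avoids π (3 ∷ 2 ∷ 4 ∷ 1 ∷ [])))
              (avoids-contains s⊆π std≡))
        (∧-zeroʳ _)

contains-3241 : ∀ {s π} → s ⊆ π → standardize s ≡ 3 ∷ 2 ∷ 4 ∷ 1 ∷ [] → inP132 π ≡ false
contains-3241 {π = π} s⊆π std≡ =
  trans (cong (λ b → avoids π (1 ∷ 3 ∷ 2 ∷ []) ∧ (avoids π (2 ∷ 3 ∷ 4 ∷ 1 ∷ []) ∧ b))
              (avoids-contains s⊆π std≡))
        (trans (cong (avoids π (1 ∷ 3 ∷ 2 ∷ []) ∧_) (∧-zeroʳ _)) (∧-zeroʳ _))

standardize-132 : ∀ {a b c} → a < c → c < b → standardize (a ∷ b ∷ c ∷ []) ≡ 1 ∷ 3 ∷ 2 ∷ []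
standardize-132 {a} {b} {c} a<c c<b =
  trans (standardize-min-∷ (b ∷ c ∷ []) (<-trans a<c c<b ∷ a<c ∷ []))
        (cong (λ t → 1 ∷ map suc t)
              (trans (standardize-max-∷ (c ∷ []) (c<b ∷ [])) (cong (2 ∷_) standardize-[ c ])))

standardize-2341 : ∀ {a b c d} → d < a → a < b → b < c →
  standardize (a ∷ b ∷ c ∷ d ∷ []) ≡ 2 ∷ 3 ∷ 4 ∷ 1 ∷ []
standardize-2341 {a} {b} {c} d<a a<b b<c =
  trans (standardize-∷ʳ-min (a ∷ b ∷ c ∷ []) (d<a ∷ d<b ∷ <-trans d<b b<c ∷ []))
        (cong (λ t → map suc t ++ 1 ∷ []) (standardize-increasing (a<b ∷ b<c ∷ [-])))
  where d<b = <-trans d<a a<b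

standardize-3241 : ∀ {a b c d} → d < b → b < a → a < c →
  standardize (a ∷ b ∷ c ∷ d ∷ []) ≡ 3 ∷ 2 ∷ 4 ∷ 1 ∷ []
standardize-3241 {a} {b} {c} d<b b<a a<c =
  trans (standardize-∷ʳ-min (a ∷ b ∷ c ∷ []) (<-trans d<b b<a ∷ d<b ∷ <-trans (<-trans d<b b<a) a<c ∷ []))
        (cong (λ t → map suc t ++ 1 ∷ [])
          (trans (standardize-∷ʳ-max (a ∷ b ∷ []) (a<c ∷ <-trans b<a a<c ∷ []))
                 (cong (_++ 3 ∷ [])
                       (trans (standardize-max-∷ (b ∷ []) (b<a ∷ [])) (cong (2 ∷_) standardize-[ b ])))))

-- A larger entry b after the head gives the 132-occurrence s₀ y b.
inP132-second-nonmax : ∀ {s₀ y σ} → s₀ < y → All (_< y) σ → All (s₀ ≢_) σ → ¬ All (_< s₀) σ →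
  inP132 (s₀ ∷ y ∷ σ) ≡ false
inP132-second-nonmax {s₀} {σ = σ} s₀<y σ<y s₀∉σ σ≮s₀ =
  let b , b∈σ , b≮s₀ = find (Allₚ.¬All⇒Any¬ (_<? s₀) σ σ≮s₀)
      s₀<b = ≤∧≢⇒< (≮⇒≥ b≮s₀) (All.lookup s₀∉σ b∈σ)
  in contains-132 (refl ∷ refl ∷ from∈ b∈σ) (standardize-132 s₀<b (All.lookup σ<y b∈σ))

-- Depending on the order of s₀, s₁ and b, one of s₀ y b, s₁ y b, s₀ s₁ y b is a 132, 2341 or 3241.
inP132-pair-then-descent : ∀ {s₀ s₁ y b π} → y ∷ b ∷ [] ⊆ π → s₀ < y → s₁ < y → b < y →
  s₀ ≢ b → s₁ ≢ b → s₀ ≢ s₁ → inP132 (s₀ ∷ s₁ ∷ π) ≡ false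
inP132-pair-then-descent {s₀} {s₁} {y} {b} yb⊆π s₀<y s₁<y b<y s₀≢b s₁≢b s₀≢s₁ with <-cmp s₀ b
... | tri< s₀<b _ _ = contains-132 (refl ∷ s₁ ∷ʳ yb⊆π) (standardize-132 s₀<b b<y)
... | tri≈ _ s₀≡b _ = ⊥-elim (s₀≢b s₀≡b)
... | tri> _ _ b<s₀ with <-cmp s₁ b
...   | tri< s₁<b _ _ = contains-132 (s₀ ∷ʳ refl ∷ yb⊆π) (standardize-132 s₁<b b<y)
...   | tri≈ _ s₁≡b _ = ⊥-elim (s₁≢b s₁≡b)
...   | tri> _ _ b<s₁ with <-cmp s₀ s₁
...     | tri< s₀<s₁ _ _ = contains-2341 (refl ∷ refl ∷ yb⊆π) (standardize-2341 b<s₀ s₀<s₁ s₁<y)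
...     | tri≈ _ s₀≡s₁ _ = ⊥-elim (s₀≢s₁ s₀≡s₁)
...     | tri> _ _ s₁<s₀ = contains-3241 (refl ∷ refl ∷ yb⊆π) (standardize-3241 b<s₁ s₁<s₀ s₀<y)

inP132-insert-deep : ∀ {s₀ s₁ y b} α β →
  All (_< y) (s₀ ∷ s₁ ∷ α ++ b ∷ β) → Unique (s₀ ∷ s₁ ∷ α ++ b ∷ β) →
  inP132 (s₀ ∷ s₁ ∷ α ++ y ∷ b ∷ β) ≡ false
inP132-insert-deep α β (s₀<y ∷ s₁<y ∷ rest<y) ((s₀≢s₁ ∷ s₀≢rest) ∷ (s₁≢rest ∷ _)) =
  inP132-pair-then-descent (++⁺ˡ α (refl ∷ refl ∷ minimum β)) s₀<y s₁<y
    (at-b rest<y) (at-b s₀≢rest) (at-b s₁≢rest) s₀≢s₁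
  where
  at-b : ∀ {P : ℕ → Set} {b} → All P (α ++ b ∷ β) → P b
  at-b all with Allₚ.++⁻ʳ α all
  ... | pb ∷ _ = pb

#inc : ℕ → List ℕ → ℕ
#inc k π = countSub (matches (oneTo k)) k π

occurrences-incPat : ∀ k π → occurrences (incPat k) π ≡ #inc k π
occurrences-incPat k π =
  trans (occurrences≡countSub (oneTo k) π) (cong (λ m → countSub (matches (oneTo k)) m π) (length-oneTo k))

#inc-max-∷ : ∀ {y σ} → All (_< y) σ → ∀ k → #inc (2 + k) (y ∷ σ) ≡ #inc (2 + k) σ
#inc-max-∷ σ<y k = countSub-matches-max-∷ σ<y (λ ()) (2 + k)

#inc-second-max : ∀ {s₀ y σ} → All (_< s₀) σ → s₀ < y → ∀ k →
  #inc (3 + k) (s₀ ∷ y ∷ σ) ≡ #inc (3 + k) (s₀ ∷ σ)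
#inc-second-max σ<s₀ s₀<y k = countSub-matches-second-max σ<s₀ s₀<y (λ ()) (λ { (() , _) }) (3 + k)

#inc-2-second-max : ∀ {s₀ y σ} → All (_< s₀) σ → s₀ < y → #inc 2 (s₀ ∷ y ∷ σ) ≡ suc (#inc 2 (s₀ ∷ σ))
#inc-2-second-max {s₀} {y} {σ} σ<s₀ s₀<y = begin
  #inc 2 (s₀ ∷ y ∷ σ)                                  ≡⟨ countSub-insert P 2 (s₀ ∷ []) y σ ⟩
  #inc 2 (s₀ ∷ σ) + countThrough P 2 (s₀ ∷ []) y σ     ≡⟨ cong (#inc 2 (s₀ ∷ σ) +_) through-y ⟩
  #inc 2 (s₀ ∷ σ) + 1                                  ≡⟨ +-comm _ 1 ⟩
  suc (#inc 2 (s₀ ∷ σ))                                ∎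
  where
  open ≡-Reasoning
  P = matches (1 ∷ 2 ∷ [])
  s₀y-increasing : standardize (s₀ ∷ y ∷ []) ≡ 1 ∷ 2 ∷ []
  s₀y-increasing = standardize-increasing (s₀<y ∷ [-])
  through-y : countSub (P ∘ (s₀ ∷_) ∘ (y ∷_)) 0 σ + countSub (P ∘ (y ∷_)) 1 σ ≡ 1
  through-y = cong₂ _+_
    (trans (countSub-zero (P ∘ (s₀ ∷_) ∘ (y ∷_)) σ)
           (cong 𝟙 (matches-true {s = s₀ ∷ y ∷ []} s₀y-increasing)))
    (countSub-none {P ∘ (y ∷_)} 1 σ λ s⊆σ →
      matches-max-∷ {t = 1} (All.map (λ x<s₀ → <-trans x<s₀ s₀<y) (All-resp-⊆ s⊆σ σ<s₀)) (λ ()))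

#inc-∷ʳ-max : ∀ {y σ} → All (_< y) σ → ∀ k → #inc (suc k) (σ ++ y ∷ []) ≡ #inc (suc k) σ + #inc k σ
#inc-∷ʳ-max {y} {σ} σ<y k = begin
  #inc (suc k) (σ ++ y ∷ [])
    ≡⟨ countSub-insert P (suc k) σ y [] ⟩
  countSub P (suc k) (σ ++ []) + countThrough P (suc k) σ y []
    ≡⟨ cong₂ _+_ (cong (countSub P (suc k)) (++-identityʳ σ)) (countThrough-last P k σ y) ⟩
  #inc (suc k) σ + countSub (λ s → P (s ++ y ∷ [])) k σ
    ≡⟨ cong (#inc (suc k) σ +_) (countSub-cong k σ λ s⊆σ → drop-y (All-resp-⊆ s⊆σ σ<y)) ⟩
  #inc (suc k) σ + #inc k σ ∎
  where
  open ≡-Reasoning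
  P = matches (oneTo (suc k))
  drop-y : ∀ {s} → All (_< y) s → P (s ++ y ∷ []) ≡ matches (oneTo k) s
  drop-y {s} s<y = matches-⇔
    (λ std≡ → ∷ʳ-injectiveˡ (standardize s) (oneTo k)
                 (trans (sym (standardize-∷ʳ-max s s<y)) (trans std≡ (oneTo-∷ʳ k))))
    (λ std≡ → trans (standardize-∷ʳ-max s s<y)
                 (trans (cong₂ (λ t m → t ++ suc m ∷ []) std≡ (|s|≡k std≡)) (sym (oneTo-∷ʳ k))))
    where
    |s|≡k : standardize s ≡ oneTo k → length s ≡ k
    |s|≡k std≡ = trans (sym (length-standardize s)) (trans (cong length std≡) (length-oneTo k))

#inc-one : ∀ L → #inc 1 L ≡ length L
#inc-one [] = refl
#inc-one (x ∷ L) =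
  trans (countSub-∷ (matches (1 ∷ [])) 0 x L)
        (cong₂ _+_ (trans (countSub-zero (matches (1 ∷ []) ∘ (x ∷_)) L)
                          (cong 𝟙 (matches-true {s = x ∷ []} standardize-[ x ])))
                   (#inc-one L))

-- Dropping either of the two smallest entries of an increasing subsequence of length k + 2
-- leaves two different increasing subsequences of length k + 1.
#inc-grow : ∀ k L → 1 ≤ #inc (2 + k) L → 2 ≤ #inc (1 + k) L
#inc-grow k L count≥1 with countSub-witness (matches (oneTo (2 + k))) (2 + k) L count≥1
... | a ∷ b ∷ s , ab⊆L , |abs|≡ , ab-matches =
  subst (λ m → 2 ≤ countSub (matches (oneTo (1 + k))) m L) |as|≡
    (countSub-two (⊆-trans (refl ∷ b ∷ʳ ⊆-refl) ab⊆L) (⊆-trans (a ∷ʳ ⊆-refl) ab⊆L) refl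
       (λ as≡bs → <-irrefl (∷-injectiveˡ as≡bs) a<b)
       (matches-true (standardize-k (increasing-drop-second increasing)))
       (matches-true (standardize-k (Linked.tail increasing))))
  where
  |as|≡ = suc-injective |abs|≡
  increasing : Linked _<_ (a ∷ b ∷ s)
  increasing = standardize-oneTo⇒increasing (matches-sound {oneTo (2 + k)} {a ∷ b ∷ s} ab-matches)
  a<b = Linked.head increasing
  standardize-k : ∀ {x} → Linked _<_ (x ∷ s) → standardize (x ∷ s) ≡ oneTo (1 + k)
  standardize-k inc = trans (standardize-increasing inc) (cong oneTo |as|≡)

+≡ᵇ1-absorb : ∀ m n → (1 ≤ m → 2 ≤ n) → (m + n ≡ᵇ 1) ≡ (n ≡ᵇ 1)
+≡ᵇ1-absorb zero n _ = refl
+≡ᵇ1-absorb (suc m) (suc (suc n)) _ rewrite +-suc m (suc n) = refl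
+≡ᵇ1-absorb (suc m) (suc zero) grow with grow (s≤s z≤n)
... | s≤s ()
+≡ᵇ1-absorb (suc m) zero grow with grow (s≤s z≤n)
... | ()

-- Counting by inserting the maximum

headIsMax : List ℕ → Bool
headIsMax (a ∷ b ∷ s) = does (all? (_<? a) (b ∷ s))
headIsMax _ = false

headIsMax⇒ : ∀ {a s} → headIsMax (a ∷ s) ≡ true → All (_< a) s
headIsMax⇒ {a} {b ∷ s} h with all? (_<? a) (b ∷ s)
... | yes s<a = s<a
... | no s≮a = case trans (sym h) (dec-false (all? (_<? a) (b ∷ s)) s≮a) of λ ()

headIsMax-max-∷ : ∀ {y s₀ σ} → All (_< y) (s₀ ∷ σ) → headIsMax (y ∷ s₀ ∷ σ) ≡ true
headIsMax-max-∷ {y} {s₀} {σ} = dec-true (all? (_<? y) (s₀ ∷ σ))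

headIsMax-second-max : ∀ {s₀ y σ} → s₀ < y → headIsMax (s₀ ∷ y ∷ σ) ≡ false
headIsMax-second-max {s₀} {y} {σ} s₀<y =
  dec-false (all? (_<? s₀) (y ∷ σ)) λ { (y<s₀ ∷ _) → <-asym s₀<y y<s₀ }

headIsMax-∷ʳ-max : ∀ {s₀ y} σ → s₀ < y → headIsMax (s₀ ∷ σ ++ y ∷ []) ≡ false
headIsMax-∷ʳ-max [] s₀<y = headIsMax-second-max {σ = []} s₀<y
headIsMax-∷ʳ-max {s₀} {y} (s₁ ∷ σ) s₀<y =
  dec-false (all? (_<? s₀) (s₁ ∷ σ ++ y ∷ [])) λ σy<s₀ → <-asym s₀<y (proj₂ (Allₚ.∷ʳ⁻ {xs = s₁ ∷ σ} σy<s₀))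

-- Insertions at any other position contain a 132, 2341 or 3241.
∑-insertions-max : ∀ (g : List ℕ → ℕ) {y s₀ σ} → (∀ π → inP132 π ≡ false → g π ≡ 0) →
  All (_< y) (s₀ ∷ σ) → Unique (s₀ ∷ σ) →
  ∑ g (insertions y (s₀ ∷ σ)) ≡
    g (y ∷ s₀ ∷ σ) + (if headIsMax (s₀ ∷ σ) then g (s₀ ∷ y ∷ σ) else 0) + g (s₀ ∷ σ ++ y ∷ [])
∑-insertions-max g {y} {s₀} {[]} _ _ _ =
  trans (cong (g (y ∷ s₀ ∷ []) +_) (+-identityʳ _)) (cong (_+ g (s₀ ∷ y ∷ [])) (sym (+-identityʳ _)))
∑-insertions-max g {y} {s₀} {s₁ ∷ r} vanish all<y@(s₀<y ∷ σ<y) uniq@(s₀∉σ ∷ _) = begin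
  g (y ∷ s₀ ∷ s₁ ∷ r) + ∑ g (map (s₀ ∷_) (insertions y (s₁ ∷ r)))
    ≡⟨ cong (g (y ∷ s₀ ∷ s₁ ∷ r) +_) (∑-map g (s₀ ∷_) (insertions y (s₁ ∷ r))) ⟩
  g (y ∷ s₀ ∷ s₁ ∷ r) + (g (s₀ ∷ y ∷ s₁ ∷ r) + ∑ (g ∘ (s₀ ∷_)) (map (s₁ ∷_) (insertions y r)))
    ≡⟨ cong (λ t → g (y ∷ s₀ ∷ s₁ ∷ r) + (g (s₀ ∷ y ∷ s₁ ∷ r) + t))
            (trans (∑-map (g ∘ (s₀ ∷_)) (s₁ ∷_) (insertions y r)) (∑-insertions-last _ y r deep)) ⟩
  g (y ∷ s₀ ∷ s₁ ∷ r) + (g (s₀ ∷ y ∷ s₁ ∷ r) + g (s₀ ∷ s₁ ∷ r ++ y ∷ []))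
    ≡⟨ +-assoc (g (y ∷ s₀ ∷ s₁ ∷ r)) _ _ ⟨
  g (y ∷ s₀ ∷ s₁ ∷ r) + g (s₀ ∷ y ∷ s₁ ∷ r) + g (s₀ ∷ s₁ ∷ r ++ y ∷ [])
    ≡⟨ cong (λ t → g (y ∷ s₀ ∷ s₁ ∷ r) + t + g (s₀ ∷ s₁ ∷ r ++ y ∷ [])) second ⟩
  g (y ∷ s₀ ∷ s₁ ∷ r) + (if headIsMax (s₀ ∷ s₁ ∷ r) then g (s₀ ∷ y ∷ s₁ ∷ r) else 0)
    + g (s₀ ∷ s₁ ∷ r ++ y ∷ []) ∎
  where
  open ≡-Reasoning
  deep : ∀ α b β → r ≡ α ++ b ∷ β → g (s₀ ∷ s₁ ∷ α ++ y ∷ b ∷ β) ≡ 0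
  deep α b β refl = vanish _ (inP132-insert-deep α β all<y uniq)
  second : g (s₀ ∷ y ∷ s₁ ∷ r) ≡ (if headIsMax (s₀ ∷ s₁ ∷ r) then g (s₀ ∷ y ∷ s₁ ∷ r) else 0)
  second with headIsMax (s₀ ∷ s₁ ∷ r) in not-max
  ... | true = refl
  ... | false = vanish _ (inP132-second-nonmax s₀<y σ<y s₀∉σ λ σ<s₀ →
                  case trans (sym (headIsMax-max-∷ σ<s₀)) not-max of λ ())

inP132∧#inc≡ : ℕ → ℕ → List ℕ → Bool
inP132∧#inc≡ k c π = inP132 π ∧ (#inc k π ≡ᵇ c)

headIsMax∧ : (List ℕ → Bool) → List ℕ → Bool
headIsMax∧ R π = headIsMax π ∧ R π

#inc≡-max-∷ : ∀ k c {y σ} → All (_< y) σ → inP132∧#inc≡ (2 + k) c (y ∷ σ) ≡ inP132∧#inc≡ (2 + k) c σ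
#inc≡-max-∷ k c σ<y = cong₂ _∧_ (inP132-max-∷ σ<y) (cong (_≡ᵇ c) (#inc-max-∷ σ<y k))

#inc≡-second-max : ∀ k c {s₀ y σ} → All (_< s₀) σ → s₀ < y →
  inP132∧#inc≡ (3 + k) c (s₀ ∷ y ∷ σ) ≡ inP132∧#inc≡ (3 + k) c (s₀ ∷ σ)
#inc≡-second-max k c σ<s₀ s₀<y =
  cong₂ _∧_ (inP132-second-max σ<s₀ s₀<y) (cong (_≡ᵇ c) (#inc-second-max σ<s₀ s₀<y k))

#inc≡-2-second-max : ∀ c {s₀ y σ} → All (_< s₀) σ → s₀ < y →
  inP132∧#inc≡ 2 (suc c) (s₀ ∷ y ∷ σ) ≡ inP132∧#inc≡ 2 c (s₀ ∷ σ)
#inc≡-2-second-max c σ<s₀ s₀<y =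
  cong₂ _∧_ (inP132-second-max σ<s₀ s₀<y) (cong (_≡ᵇ suc c) (#inc-2-second-max σ<s₀ s₀<y))

#inc≡0-2-second-max : ∀ {s₀ y σ} → All (_< s₀) σ → s₀ < y → inP132∧#inc≡ 2 0 (s₀ ∷ y ∷ σ) ≡ false
#inc≡0-2-second-max {s₀} {y} {σ} σ<s₀ s₀<y =
  trans (cong (λ m → inP132 (s₀ ∷ y ∷ σ) ∧ (m ≡ᵇ 0)) (#inc-2-second-max σ<s₀ s₀<y)) (∧-zeroʳ _)

#inc≡1-∷ʳ-max : ∀ k {y σ} → All (_< y) σ →
  inP132∧#inc≡ (2 + k) 1 (σ ++ y ∷ []) ≡ inP132∧#inc≡ (1 + k) 1 σ
#inc≡1-∷ʳ-max k {σ = σ} σ<y =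
  cong₂ _∧_ (inP132-∷ʳ-max σ<y)
    (trans (cong (_≡ᵇ 1) (#inc-∷ʳ-max σ<y (1 + k))) (+≡ᵇ1-absorb _ _ (#inc-grow k σ)))

#inc≡0-2-∷ʳ-max : ∀ {y s₀ σ} → All (_< y) (s₀ ∷ σ) → inP132∧#inc≡ 2 0 (s₀ ∷ σ ++ y ∷ []) ≡ false
#inc≡0-2-∷ʳ-max {y} {s₀} {σ} σ<y = trans (cong (λ m → inP132 (s₀ ∷ σ ++ y ∷ []) ∧ (m ≡ᵇ 0)) (begin
  #inc 2 (s₀ ∷ σ ++ y ∷ [])                    ≡⟨ #inc-∷ʳ-max σ<y 1 ⟩
  #inc 2 (s₀ ∷ σ) + #inc 1 (s₀ ∷ σ)            ≡⟨ cong (#inc 2 (s₀ ∷ σ) +_) (#inc-one (s₀ ∷ σ)) ⟩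
  #inc 2 (s₀ ∷ σ) + suc (length σ)             ≡⟨ +-suc _ _ ⟩
  suc (#inc 2 (s₀ ∷ σ) + length σ)             ∎)) (∧-zeroʳ _)
  where open ≡-Reasoning

#inc≡1-1-length≥2 : ∀ s₀ s₁ σ → inP132∧#inc≡ 1 1 (s₀ ∷ s₁ ∷ σ) ≡ false
#inc≡1-1-length≥2 s₀ s₁ σ =
  trans (cong (λ m → inP132 (s₀ ∷ s₁ ∷ σ) ∧ (m ≡ᵇ 1)) (#inc-one (s₀ ∷ s₁ ∷ σ))) (∧-zeroʳ _)

𝟙-#inc≡-∉P132 : ∀ k c π → inP132 π ≡ false → 𝟙 (inP132∧#inc≡ k c π) ≡ 0
𝟙-#inc≡-∉P132 k c π not-in = cong (λ b → 𝟙 (b ∧ (#inc k π ≡ᵇ c))) not-in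

𝟙-headIsMax∧-∉P132 : ∀ k c π → inP132 π ≡ false → 𝟙 (headIsMax∧ (inP132∧#inc≡ k c) π) ≡ 0
𝟙-headIsMax∧-∉P132 k c π not-in =
  cong 𝟙 (trans (cong (λ b → headIsMax π ∧ (b ∧ (#inc k π ≡ᵇ c))) not-in) (∧-zeroʳ (headIsMax π)))

if-then-𝟙 : ∀ h {a} {b : Bool} → (h ≡ true → a ≡ 𝟙 b) → (if h then a else 0) ≡ 𝟙 (h ∧ b)
if-then-𝟙 true a≡ = a≡ refl
if-then-𝟙 false _ = refl

if-then-0 : ∀ h {a} → (h ≡ true → a ≡ 0) → (if h then a else 0) ≡ 0
if-then-0 true a≡ = a≡ refl
if-then-0 false _ = refl

module _ {y s₀ σ} (σ<y : All (_< y) (s₀ ∷ σ)) (unique : Unique (s₀ ∷ σ)) where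

  private
    s₀<y = All.head σ<y

  ∑-insertions-#inc≡1 : ∀ k →
    ∑ (𝟙 ∘ inP132∧#inc≡ (3 + k) 1) (insertions y (s₀ ∷ σ)) ≡
      𝟙 (inP132∧#inc≡ (3 + k) 1 (s₀ ∷ σ)) + 𝟙 (headIsMax∧ (inP132∧#inc≡ (3 + k) 1) (s₀ ∷ σ))
        + 𝟙 (inP132∧#inc≡ (2 + k) 1 (s₀ ∷ σ))
  ∑-insertions-#inc≡1 k =
    trans (∑-insertions-max (𝟙 ∘ inP132∧#inc≡ (3 + k) 1) {y} {s₀} {σ}
                            (𝟙-#inc≡-∉P132 (3 + k) 1) σ<y unique)
      (cong₂ _+_ (cong₂ _+_ (cong 𝟙 (#inc≡-max-∷ (1 + k) 1 σ<y))
                            (if-then-𝟙 (headIsMax (s₀ ∷ σ)) λ h →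
                               cong 𝟙 (#inc≡-second-max k 1 {s₀} {y} {σ} (headIsMax⇒ h) s₀<y)))
                 (cong 𝟙 (#inc≡1-∷ʳ-max (1 + k) σ<y)))

  ∑-insertions-headIsMax∧ : ∀ k c →
    ∑ (𝟙 ∘ headIsMax∧ (inP132∧#inc≡ (2 + k) c)) (insertions y (s₀ ∷ σ)) ≡ 𝟙 (inP132∧#inc≡ (2 + k) c (s₀ ∷ σ))
  ∑-insertions-headIsMax∧ k c = begin
    ∑ (𝟙 ∘ R) (insertions y (s₀ ∷ σ))
      ≡⟨ ∑-insertions-max (𝟙 ∘ R) {y} {s₀} {σ} (𝟙-headIsMax∧-∉P132 (2 + k) c) σ<y unique ⟩
    𝟙 (R (y ∷ s₀ ∷ σ)) + (if headIsMax (s₀ ∷ σ) then 𝟙 (R (s₀ ∷ y ∷ σ)) else 0) + 𝟙 (R (s₀ ∷ σ ++ y ∷ []))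
      ≡⟨ cong₂ _+_ (cong₂ _+_ front (if-then-0 (headIsMax (s₀ ∷ σ)) λ _ → second)) last ⟩
    𝟙 (inP132∧#inc≡ (2 + k) c (s₀ ∷ σ)) + 0 + 0
      ≡⟨ trans (+-identityʳ _) (+-identityʳ _) ⟩
    𝟙 (inP132∧#inc≡ (2 + k) c (s₀ ∷ σ)) ∎
    where
    open ≡-Reasoning
    R = headIsMax∧ (inP132∧#inc≡ (2 + k) c)
    front = cong 𝟙 (cong₂ _∧_ (headIsMax-max-∷ σ<y) (#inc≡-max-∷ k c σ<y))
    second = cong (λ h → 𝟙 (h ∧ inP132∧#inc≡ (2 + k) c (s₀ ∷ y ∷ σ))) (headIsMax-second-max {σ = σ} s₀<y)
    last = cong (λ b → 𝟙 (b ∧ inP132∧#inc≡ (2 + k) c (s₀ ∷ σ ++ y ∷ []))) (headIsMax-∷ʳ-max σ s₀<y)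

  ∑-insertions-#inc≡0 : ∑ (𝟙 ∘ inP132∧#inc≡ 2 0) (insertions y (s₀ ∷ σ)) ≡ 𝟙 (inP132∧#inc≡ 2 0 (s₀ ∷ σ))
  ∑-insertions-#inc≡0 =
    trans (∑-insertions-max (𝟙 ∘ inP132∧#inc≡ 2 0) {y} {s₀} {σ} (𝟙-#inc≡-∉P132 2 0) σ<y unique)
      (trans (cong₂ _+_ (cong₂ _+_ (cong 𝟙 (#inc≡-max-∷ 0 0 σ<y))
                                   (if-then-0 (headIsMax (s₀ ∷ σ)) λ h →
                                      cong 𝟙 (#inc≡0-2-second-max {s₀} {y} {σ} (headIsMax⇒ h) s₀<y)))
                        (cong 𝟙 (#inc≡0-2-∷ʳ-max σ<y)))
             (trans (+-identityʳ _) (+-identityʳ _)))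

∑-insertions-#inc≡1-2 : ∀ {y s₀ s₁ σ} → All (_< y) (s₀ ∷ s₁ ∷ σ) → Unique (s₀ ∷ s₁ ∷ σ) →
  ∑ (𝟙 ∘ inP132∧#inc≡ 2 1) (insertions y (s₀ ∷ s₁ ∷ σ)) ≡
    𝟙 (inP132∧#inc≡ 2 1 (s₀ ∷ s₁ ∷ σ)) + 𝟙 (headIsMax∧ (inP132∧#inc≡ 2 0) (s₀ ∷ s₁ ∷ σ))
∑-insertions-#inc≡1-2 {y} {s₀} {s₁} {σ} σ<y unique =
  trans (∑-insertions-max (𝟙 ∘ inP132∧#inc≡ 2 1) {y} {s₀} {s₁ ∷ σ} (𝟙-#inc≡-∉P132 2 1) σ<y unique)
    (trans (cong₂ _+_ (cong₂ _+_ (cong 𝟙 (#inc≡-max-∷ 0 1 σ<y))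
                                 (if-then-𝟙 (headIsMax (s₀ ∷ s₁ ∷ σ)) λ h →
                                    cong 𝟙 (#inc≡-2-second-max 0 {s₀} {y} {s₁ ∷ σ}
                                                (headIsMax⇒ {s₀} {s₁ ∷ σ} h) (All.head σ<y))))
                      (cong 𝟙 (trans (#inc≡1-∷ʳ-max 0 σ<y) (#inc≡1-1-length≥2 s₀ s₁ σ))))
           (+-identityʳ _))

insertions-All : ∀ {P : ℕ → Set} {y} σ → P y → All P σ → All (All P) (insertions y σ)
insertions-All [] py [] = (py ∷ []) ∷ []
insertions-All (z ∷ σ) py (pz ∷ pσ) =
  (py ∷ pz ∷ pσ) ∷ Allₚ.map⁺ (All.map (pz ∷_) (insertions-All σ py pσ))

insertions-length : ∀ y σ → All (λ π → length π ≡ suc (length σ)) (insertions y σ)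
insertions-length y [] = refl ∷ []
insertions-length y (z ∷ σ) = refl ∷ Allₚ.map⁺ (All.map (cong suc) (insertions-length y σ))

insertions-Unique : ∀ {y} σ → All (y ≢_) σ → Unique σ → All Unique (insertions y σ)
insertions-Unique [] [] [] = ([] ∷ []) ∷ []
insertions-Unique {y} (z ∷ σ) (y≢z ∷ y∉σ) (z∉σ ∷ unique) =
  ((y≢z ∷ y∉σ) ∷ z∉σ ∷ unique) ∷
  Allₚ.map⁺ (All.zipWith (λ (z∉π , uπ) → z∉π ∷ uπ)
                          (insertions-All σ (y≢z ∘ sym) z∉σ , insertions-Unique σ y∉σ unique))

-- perms inserts the head of its list last, so listing the entries downwards makes every step
-- insert a new maximum; S′ n is S n up to order (b≡count).
S′ : ℕ → List (List ℕ)
S′ n = perms (map suc (downFrom n))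

S′-invariant : ∀ n → All (λ σ → All (_< suc n) σ × Unique σ × length σ ≡ n) (S′ n)
S′-invariant zero = ([] , [] , refl) ∷ []
S′-invariant (suc n) = Allₚ.concat⁺ (Allₚ.map⁺ (All.map step (S′-invariant n)))
  where
  step : ∀ {σ} → All (_< suc n) σ × Unique σ × length σ ≡ n →
    All (λ π → All (_< suc (suc n)) π × Unique π × length π ≡ suc n) (insertions (suc n) σ)
  step {σ} (σ<n , unique , |σ|≡n) =
    All.zipWith (λ (π<n , uπ , |π|) → π<n , uπ , trans |π| (cong suc |σ|≡n))
      (insertions-All σ ≤-refl (All.map m≤n⇒m≤1+n σ<n) ,
       All.zip (insertions-Unique σ (All.map (λ x<y y≡x → <-irrefl (sym y≡x) x<y) σ<n) unique ,
                insertions-length (suc n) σ))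

count : (List ℕ → Bool) → ℕ → ℕ
count R n = ∑ (𝟙 ∘ R) (S′ n)

count-suc : ∀ R n (h : List ℕ → ℕ) →
  (∀ {σ} → All (_< suc n) σ → Unique σ → length σ ≡ n → ∑ (𝟙 ∘ R) (insertions (suc n) σ) ≡ h σ) →
  count R (suc n) ≡ ∑ h (S′ n)
count-suc R n h step =
  trans (∑-concatMap (𝟙 ∘ R) (insertions (suc n)) (S′ n))
        (∑-cong-All (All.map (λ (σ<n , unique , |σ|≡n) → step σ<n unique |σ|≡n) (S′-invariant n)))

b≡count : ∀ k n → b (incPat k) n ≡ count (inP132∧#inc≡ k 1) n
b≡count k n = begin
  b (incPat k) n
    ≡⟨ length-filter≡∑ (T? ∘ p) (S n) ⟩
  ∑ (𝟙 ∘ p) (S n)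
    ≡⟨ ∑-cong (λ π → cong (λ m → 𝟙 (inP132 π ∧ (m ≡ᵇ 1))) (occurrences-incPat k π)) (S n) ⟩
  ∑ (𝟙 ∘ inP132∧#inc≡ k 1) (S n)
    ≡⟨ ∑-perms-↭ (↭.map⁺ suc upTo↭downFrom) _ ⟩
  count (inP132∧#inc≡ k 1) n ∎
  where
  open ≡-Reasoning
  p = λ π → inP132 π ∧ (occurrences (incPat k) π ≡ᵇ 1)
  upTo↭downFrom : upTo n ↭ downFrom n
  upTo↭downFrom = subst (upTo n ↭_) (reverse-upTo n) (↭-sym (↭.↭-reverse (upTo n)))

count-#inc≡1-step : ∀ k n →
  count (inP132∧#inc≡ (3 + k) 1) (2 + n) ≡
    count (inP132∧#inc≡ (3 + k) 1) (1 + n) + count (headIsMax∧ (inP132∧#inc≡ (3 + k) 1)) (1 + n)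
      + count (inP132∧#inc≡ (2 + k) 1) (1 + n)
count-#inc≡1-step k n =
  trans (count-suc R (suc n) (λ σ → 𝟙 (R σ) + 𝟙 (headIsMax∧ R σ) + 𝟙 (R′ σ))
                   λ { {s₀ ∷ σ} σ<y unique _ → ∑-insertions-#inc≡1 σ<y unique k })
        (trans (∑-+ (λ σ → 𝟙 (R σ) + 𝟙 (headIsMax∧ R σ)) (𝟙 ∘ R′) (S′ (suc n)))
               (cong (_+ count R′ (suc n)) (∑-+ (𝟙 ∘ R) (𝟙 ∘ headIsMax∧ R) (S′ (suc n)))))
  where
  R = inP132∧#inc≡ (3 + k) 1
  R′ = inP132∧#inc≡ (2 + k) 1

count-headIsMax∧ : ∀ k c n →
  count (headIsMax∧ (inP132∧#inc≡ (2 + k) c)) (2 + n) ≡ count (inP132∧#inc≡ (2 + k) c) (1 + n)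
count-headIsMax∧ k c n = count-suc _ (suc n) (𝟙 ∘ inP132∧#inc≡ (2 + k) c)
  λ { {s₀ ∷ σ} σ<y unique _ → ∑-insertions-headIsMax∧ σ<y unique k c }

count-#inc≡0-2-step : ∀ n → count (inP132∧#inc≡ 2 0) (2 + n) ≡ count (inP132∧#inc≡ 2 0) (1 + n)
count-#inc≡0-2-step n = count-suc _ (suc n) (𝟙 ∘ inP132∧#inc≡ 2 0)
  λ { {s₀ ∷ σ} σ<y unique _ → ∑-insertions-#inc≡0 σ<y unique }

count-#inc≡1-2-step : ∀ n →
  count (inP132∧#inc≡ 2 1) (3 + n) ≡ count (inP132∧#inc≡ 2 1) (2 + n) + count (headIsMax∧ (inP132∧#inc≡ 2 0)) (2 + n)
count-#inc≡1-2-step n =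
  trans (count-suc _ (2 + n) (λ σ → 𝟙 (inP132∧#inc≡ 2 1 σ) + 𝟙 (headIsMax∧ (inP132∧#inc≡ 2 0) σ))
                   λ { {s₀ ∷ s₁ ∷ σ} σ<y unique _ → ∑-insertions-#inc≡1-2 σ<y unique })
        (∑-+ (𝟙 ∘ inP132∧#inc≡ 2 1) (𝟙 ∘ headIsMax∧ (inP132∧#inc≡ 2 0)) (S′ (2 + n)))

-- Only the decreasing permutation avoids 12.
count-#inc≡0-2 : ∀ n → count (inP132∧#inc≡ 2 0) (suc n) ≡ 1
count-#inc≡0-2 zero = refl
count-#inc≡0-2 (suc n) = trans (count-#inc≡0-2-step n) (count-#inc≡0-2 n)

count-#inc≡1-2 : ∀ n → count (inP132∧#inc≡ 2 1) (suc n) ≡ n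
count-#inc≡1-2 zero = refl
count-#inc≡1-2 (suc zero) = refl
count-#inc≡1-2 (suc (suc n)) = begin
  count (inP132∧#inc≡ 2 1) (3 + n)
    ≡⟨ count-#inc≡1-2-step n ⟩
  count (inP132∧#inc≡ 2 1) (2 + n) + count (headIsMax∧ (inP132∧#inc≡ 2 0)) (2 + n)
    ≡⟨ cong₂ _+_ (count-#inc≡1-2 (suc n)) (trans (count-headIsMax∧ 0 0 n) (count-#inc≡0-2 n)) ⟩
  suc n + 1
    ≡⟨ +-comm (suc n) 1 ⟩
  suc (suc n) ∎
  where open ≡-Reasoning

count-#inc≡1-rec : ∀ k n →
  count (inP132∧#inc≡ (3 + k) 1) (2 + n) ≡
    count (inP132∧#inc≡ (3 + k) 1) (1 + n) + count (inP132∧#inc≡ (3 + k) 1) n + count (inP132∧#inc≡ (2 + k) 1) (1 + n)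
count-#inc≡1-rec k zero = refl
count-#inc≡1-rec k (suc n) =
  trans (count-#inc≡1-step k (suc n))
        (cong (λ m → count (inP132∧#inc≡ (3 + k) 1) (2 + n) + m + count (inP132∧#inc≡ (2 + k) 1) (2 + n))
              (count-headIsMax∧ (suc k) 1 n))

-- Formal power series

sumTo-cong≤ : ∀ n {h h′ : ℕ → ℤ} → (∀ k → k ≤ n → h k ≡ h′ k) → sumTo n h ≡ sumTo n h′
sumTo-cong≤ zero h≡ = h≡ 0 z≤n
sumTo-cong≤ (suc n) h≡ = cong₂ _+ℤ_ (sumTo-cong≤ n (λ k k≤n → h≡ k (m≤n⇒m≤1+n k≤n))) (h≡ (suc n) ≤-refl)

sumTo-cong : ∀ n {h h′ : ℕ → ℤ} → (∀ k → h k ≡ h′ k) → sumTo n h ≡ sumTo n h′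
sumTo-cong n h≡ = sumTo-cong≤ n (λ k _ → h≡ k)

sumTo-suc : ∀ n (h : ℕ → ℤ) → sumTo (suc n) h ≡ h 0 +ℤ sumTo n (λ k → h (suc k))
sumTo-suc zero h = refl
sumTo-suc (suc n) h = trans (cong (_+ℤ h (suc (suc n))) (sumTo-suc n h)) (ℤ.+-assoc (h 0) _ _)

sumTo-+ : ∀ n (h h′ : ℕ → ℤ) → sumTo n (λ k → h k +ℤ h′ k) ≡ sumTo n h +ℤ sumTo n h′
sumTo-+ zero h h′ = refl
sumTo-+ (suc n) h h′ rewrite sumTo-+ n h h′ =
  solve 4 (λ a b c d → (a :+ b) :+ (c :+ d) := (a :+ c) :+ (b :+ d)) refl
    (sumTo n h) (sumTo n h′) (h (suc n)) (h′ (suc n))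
  where open ℤ-Solver.+-*-Solver

sumTo-*ˡ : ∀ n c (h : ℕ → ℤ) → c *ℤ sumTo n h ≡ sumTo n (λ k → c *ℤ h k)
sumTo-*ˡ zero c h = refl
sumTo-*ˡ (suc n) c h =
  trans (ℤ.*-distribˡ-+ c (sumTo n h) (h (suc n))) (cong (_+ℤ c *ℤ h (suc n)) (sumTo-*ˡ n c h))

sumTo-*ʳ : ∀ n c (h : ℕ → ℤ) → sumTo n h *ℤ c ≡ sumTo n (λ k → h k *ℤ c)
sumTo-*ʳ zero c h = refl
sumTo-*ʳ (suc n) c h =
  trans (ℤ.*-distribʳ-+ c (sumTo n h) (h (suc n))) (cong (_+ℤ h (suc n) *ℤ c) (sumTo-*ʳ n c h))

sumTo-reverse : ∀ n (h : ℕ → ℤ) → sumTo n h ≡ sumTo n (λ k → h (n ∸ k))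
sumTo-reverse zero h = refl
sumTo-reverse (suc n) h =
  trans (cong (_+ℤ h (suc n)) (sumTo-reverse n h))
        (trans (ℤ.+-comm _ (h (suc n))) (sym (sumTo-suc n (λ k → h (suc n ∸ k)))))

sumTo-beyond : ∀ c n (h : ℕ → ℤ) → (∀ k → c < k → h k ≡ pos 0) → c ≤ n → sumTo n h ≡ sumTo c h
sumTo-beyond c zero h _ z≤n = refl
sumTo-beyond c (suc n) h h≡0 c≤n with m≤n⇒m<n∨m≡n c≤n
... | inj₁ c<1+n =
  trans (cong₂ _+ℤ_ (sumTo-beyond c n h h≡0 (≤-pred c<1+n)) (h≡0 (suc n) c<1+n)) (ℤ.+-identityʳ _)
... | inj₂ refl = refl

sumTo-exchange : ∀ (F : ℕ → ℕ → ℤ) n →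
  sumTo n (λ i → sumTo i (F i)) ≡ sumTo n (λ j → sumTo (n ∸ j) (λ l → F (j + l) j))
sumTo-exchange F zero = refl
sumTo-exchange F (suc m) = trans (cong (_+ℤ sumTo (suc m) (F (suc m))) (sumTo-exchange F m)) (sym split)
  where
  column : ℕ → ℕ → ℤ
  column m j = sumTo (m ∸ j) (λ l → F (j + l) j)
  column-suc : ∀ j → j ≤ m → column (suc m) j ≡ column m j +ℤ F (suc m) j
  column-suc j j≤m rewrite +-∸-assoc 1 j≤m =
    cong (λ t → column m j +ℤ F t j) (trans (+-suc j (m ∸ j)) (cong suc (m+[n∸m]≡n j≤m)))
  split : sumTo (suc m) (column (suc m)) ≡ sumTo m (column m) +ℤ sumTo (suc m) (F (suc m))
  split = trans
    (cong₂ _+ℤ_ (trans (sumTo-cong≤ m column-suc) (sumTo-+ m (column m) (F (suc m))))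
                (trans (cong (λ t → sumTo t (λ l → F (suc m + l) (suc m))) (n∸n≡0 m))
                       (cong (λ t → F t (suc m)) (+-identityʳ (suc m)))))
    (ℤ.+-assoc (sumTo m (column m)) (sumTo m (F (suc m))) (F (suc m) (suc m)))

⊛-cong : ∀ {f f′ g g′} → f ≗ f′ → g ≗ g′ → (f ⊛ g) ≗ (f′ ⊛ g′)
⊛-cong f≗ g≗ n = sumTo-cong n (λ k → cong₂ _*ℤ_ (f≗ k) (g≗ (n ∸ k)))

⊛-congˡ : ∀ f {g g′} → g ≗ g′ → (f ⊛ g) ≗ (f ⊛ g′)
⊛-congˡ f = ⊛-cong {f} {f} (λ _ → refl)

⊛-congʳ : ∀ {f f′} g → f ≗ f′ → (f ⊛ g) ≗ (f′ ⊛ g)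
⊛-congʳ g f≗ = ⊛-cong {g = g} {g} f≗ (λ _ → refl)

⊛-comm : ∀ f g → (f ⊛ g) ≗ (g ⊛ f)
⊛-comm f g n =
  trans (sumTo-reverse n _)
        (sumTo-cong≤ n λ k k≤n →
          trans (cong (λ i → f (n ∸ k) *ℤ g i) (m∸[m∸n]≡n k≤n)) (ℤ.*-comm (f (n ∸ k)) (g k)))

⊛-assoc : ∀ f g h → ((f ⊛ g) ⊛ h) ≗ (f ⊛ (g ⊛ h))
⊛-assoc f g h n = begin
  sumTo n (λ i → sumTo i (λ j → f j *ℤ g (i ∸ j)) *ℤ h (n ∸ i))
    ≡⟨ sumTo-cong n (λ i → sumTo-*ʳ i (h (n ∸ i)) (λ j → f j *ℤ g (i ∸ j))) ⟩
  sumTo n (λ i → sumTo i (λ j → f j *ℤ g (i ∸ j) *ℤ h (n ∸ i)))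
    ≡⟨ sumTo-exchange (λ i j → f j *ℤ g (i ∸ j) *ℤ h (n ∸ i)) n ⟩
  sumTo n (λ j → sumTo (n ∸ j) (λ l → f j *ℤ g (j + l ∸ j) *ℤ h (n ∸ (j + l))))
    ≡⟨ sumTo-cong n (λ j → sumTo-cong (n ∸ j) (λ l → reassociate j l)) ⟩
  sumTo n (λ j → sumTo (n ∸ j) (λ l → f j *ℤ (g l *ℤ h (n ∸ j ∸ l))))
    ≡⟨ sumTo-cong n (λ j → sumTo-*ˡ (n ∸ j) (f j) (λ l → g l *ℤ h (n ∸ j ∸ l))) ⟨
  sumTo n (λ j → f j *ℤ sumTo (n ∸ j) (λ l → g l *ℤ h (n ∸ j ∸ l))) ∎
  where
  open ≡-Reasoning
  reassociate : ∀ j l → f j *ℤ g (j + l ∸ j) *ℤ h (n ∸ (j + l)) ≡ f j *ℤ (g l *ℤ h (n ∸ j ∸ l))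
  reassociate j l = trans (cong₂ (λ a b → f j *ℤ g a *ℤ h b) (m+n∸m≡n j l) (sym (∸-+-assoc n j l)))
                          (ℤ.*-assoc (f j) (g l) (h (n ∸ j ∸ l)))

oneS-⊛ : ∀ f → (oneS ⊛ f) ≗ f
oneS-⊛ f n = trans (sumTo-beyond 0 n _ (λ { (suc k) _ → refl }) z≤n) (ℤ.*-identityˡ (f n))

⊛-identityʳ : ∀ f → (f ⊛ oneS) ≗ f
⊛-identityʳ f n = trans (⊛-comm f oneS n) (oneS-⊛ f n)

shift : Series → Series
shift f zero = pos 0
shift f (suc n) = f n

shift-⊛ : ∀ f g → (shift f ⊛ g) ≗ shift (f ⊛ g)
shift-⊛ f g zero = refl
shift-⊛ f g (suc n) = trans (sumTo-suc n _) (ℤ.+-identityˡ _)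

shift-cong : ∀ {f g} → f ≗ g → shift f ≗ shift g
shift-cong f≗g zero = refl
shift-cong f≗g (suc n) = f≗g n

xPow-suc : ∀ d → xPow (suc d) ≗ shift (xPow d)
xPow-suc d zero = refl
xPow-suc d (suc n) = refl

oneMinusX-⊛ : ∀ f → (oneMinusX ⊛ f) ≗ (λ n → f n +ℤ - shift f n)
oneMinusX-⊛ f zero = trans (ℤ.*-identityˡ (f 0)) (sym (ℤ.+-identityʳ (f 0)))
oneMinusX-⊛ f (suc n) =
  trans (sumTo-beyond 1 (suc n) _ (λ { (suc zero) (s≤s ()) ; (suc (suc k)) _ → refl }) (s≤s z≤n))
        (cong₂ _+ℤ_ (ℤ.*-identityˡ (f (suc n))) (ℤ.-1*i≡-i (f n)))

oneMinusXMinusX²-⊛ : ∀ f → (oneMinusXMinusX² ⊛ f) ≗ (λ n → f n +ℤ - shift f n +ℤ - shift (shift f) n)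
oneMinusXMinusX²-⊛ f zero = trans (ℤ.*-identityˡ (f 0)) (sym (trans (ℤ.+-identityʳ _) (ℤ.+-identityʳ (f 0))))
oneMinusXMinusX²-⊛ f (suc zero) =
  trans (cong₂ _+ℤ_ (ℤ.*-identityˡ (f 1)) (ℤ.-1*i≡-i (f 0))) (sym (ℤ.+-identityʳ _))
oneMinusXMinusX²-⊛ f (suc (suc n)) =
  trans (sumTo-beyond 2 (suc (suc n)) _ (λ { (suc zero) (s≤s ()) ; (suc (suc zero)) (s≤s (s≤s ())) ; (suc (suc (suc k))) _ → refl })
                     (s≤s (s≤s z≤n)))
        (cong₂ _+ℤ_ (cong₂ _+ℤ_ (ℤ.*-identityˡ (f (suc (suc n)))) (ℤ.-1*i≡-i (f (suc n)))) (ℤ.-1*i≡-i (f n)))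

b-incPat-2 : ∀ n → b (incPat 2) (suc n) ≡ n
b-incPat-2 n = trans (b≡count 2 (suc n)) (count-#inc≡1-2 n)

b-incPat-rec : ∀ j n →
  b (incPat (3 + j)) (2 + n) ≡ b (incPat (3 + j)) (1 + n) + b (incPat (3 + j)) n + b (incPat (2 + j)) (1 + n)
b-incPat-rec j n
  rewrite b≡count (3 + j) (2 + n) | b≡count (3 + j) (1 + n) | b≡count (3 + j) n | b≡count (2 + j) (1 + n) =
  count-#inc≡1-rec j n

B : ℕ → Series
B k = B¹ (incPat k)

B-2 : ∀ n → B 2 n ≡ pos (n ∸ 1)
B-2 zero = refl
B-2 (suc n) = cong pos (b-incPat-2 n)

B-rec : ∀ j n → B (3 + j) (2 + n) ≡ B (3 + j) (1 + n) +ℤ B (3 + j) n +ℤ B (2 + j) (1 + n)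
B-rec j n = begin
  pos (b (incPat (3 + j)) (2 + n))  ≡⟨ cong pos (b-incPat-rec j n) ⟩
  pos (b₁ + b₀ + b′)                ≡⟨ ℤ.pos-+ (b₁ + b₀) b′ ⟩
  pos (b₁ + b₀) +ℤ pos b′           ≡⟨ cong (_+ℤ pos b′) (ℤ.pos-+ b₁ b₀) ⟩
  pos b₁ +ℤ pos b₀ +ℤ pos b′        ∎
  where
  open ≡-Reasoning
  b₁ = b (incPat (3 + j)) (1 + n)
  b₀ = b (incPat (3 + j)) n
  b′ = b (incPat (2 + j)) (1 + n)

oneMinusXMinusX²-⊛-B : ∀ j → (oneMinusXMinusX² ⊛ B (3 + j)) ≗ shift (B (2 + j))
oneMinusXMinusX²-⊛-B j n = trans (oneMinusXMinusX²-⊛ (B (3 + j)) n) (coefficient n)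
  where
  open ℤ-Solver.+-*-Solver
  coefficient : ∀ n → B (3 + j) n +ℤ - shift (B (3 + j)) n +ℤ - shift (shift (B (3 + j))) n ≡ shift (B (2 + j)) n
  coefficient zero = refl
  coefficient (suc zero) = refl
  coefficient (suc (suc n)) rewrite B-rec j n =
    solve 3 (λ a b c → a :+ b :+ c :+ :- a :+ :- b := c) refl
      (B (3 + j) (suc n)) (B (3 + j) n) (B (2 + j) (suc n))

oneMinusX²-⊛-B-2 : (oneMinusX ⊛ (oneMinusX ⊛ B 2)) ≗ xPow 2
oneMinusX²-⊛-B-2 n = trans (⊛-congˡ oneMinusX first-difference n) (second-difference n)
  where
  steps : Series
  steps zero = pos 0
  steps (suc zero) = pos 0
  steps (suc (suc n)) = pos 1
  first-difference : (oneMinusX ⊛ B 2) ≗ steps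
  first-difference n = trans (oneMinusX-⊛ (B 2) n) (coefficient n)
    where
    open ℤ-Solver.+-*-Solver
    coefficient : ∀ n → B 2 n +ℤ - shift (B 2) n ≡ steps n
    coefficient zero = refl
    coefficient (suc zero) rewrite B-2 1 = refl
    coefficient (suc (suc n)) rewrite B-2 (suc (suc n)) | B-2 (suc n) =
      trans (cong (_+ℤ - pos n) (ℤ.pos-+ 1 n)) (solve 1 (λ a → con (pos 1) :+ a :+ :- a := con (pos 1)) refl (pos n))
  second-difference : (oneMinusX ⊛ steps) ≗ xPow 2
  second-difference n = trans (oneMinusX-⊛ steps n) (coefficient n)
    where
    coefficient : ∀ n → steps n +ℤ - shift steps n ≡ xPow 2 n
    coefficient zero = refl
    coefficient (suc zero) = refl
    coefficient (suc (suc zero)) = refl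
    coefficient (suc (suc (suc n))) = refl

B-⊛-denominator : ∀ j → (B (2 + j) ⊛ ((oneMinusX ^S 2) ⊛ (oneMinusXMinusX² ^S j))) ≗ xPow (2 + j)
B-⊛-denominator zero = begin
  B 2 ⊛ (U² ⊛ oneS)                         ≈⟨ ⊛-congˡ (B 2) (⊛-identityʳ U²) ⟩
  B 2 ⊛ U²                                  ≈⟨ ⊛-comm (B 2) U² ⟩
  (oneMinusX ⊛ (oneMinusX ⊛ oneS)) ⊛ B 2    ≈⟨ ⊛-assoc oneMinusX (oneMinusX ⊛ oneS) (B 2) ⟩
  oneMinusX ⊛ ((oneMinusX ⊛ oneS) ⊛ B 2)    ≈⟨ ⊛-congˡ oneMinusX (⊛-congʳ (B 2) (⊛-identityʳ oneMinusX)) ⟩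
  oneMinusX ⊛ (oneMinusX ⊛ B 2)             ≈⟨ oneMinusX²-⊛-B-2 ⟩
  xPow 2                                    ∎
  where
  open SetoidReasoning (ℕ →-setoid ℤ)
  U² = oneMinusX ^S 2
B-⊛-denominator (suc j) = begin
  B (3 + j) ⊛ (U² ⊛ (Φ ⊛ Φʲ))        ≈⟨ ⊛-congˡ (B (3 + j)) (⊛-assoc U² Φ Φʲ) ⟨
  B (3 + j) ⊛ ((U² ⊛ Φ) ⊛ Φʲ)        ≈⟨ ⊛-congˡ (B (3 + j)) (⊛-congʳ Φʲ (⊛-comm U² Φ)) ⟩
  B (3 + j) ⊛ ((Φ ⊛ U²) ⊛ Φʲ)        ≈⟨ ⊛-congˡ (B (3 + j)) (⊛-assoc Φ U² Φʲ) ⟩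
  B (3 + j) ⊛ (Φ ⊛ (U² ⊛ Φʲ))        ≈⟨ ⊛-assoc (B (3 + j)) Φ (U² ⊛ Φʲ) ⟨
  (B (3 + j) ⊛ Φ) ⊛ (U² ⊛ Φʲ)        ≈⟨ ⊛-congʳ (U² ⊛ Φʲ) (⊛-comm (B (3 + j)) Φ) ⟩
  (Φ ⊛ B (3 + j)) ⊛ (U² ⊛ Φʲ)        ≈⟨ ⊛-congʳ (U² ⊛ Φʲ) (oneMinusXMinusX²-⊛-B j) ⟩
  shift (B (2 + j)) ⊛ (U² ⊛ Φʲ)      ≈⟨ shift-⊛ (B (2 + j)) (U² ⊛ Φʲ) ⟩
  shift (B (2 + j) ⊛ (U² ⊛ Φʲ))      ≈⟨ shift-cong (B-⊛-denominator j) ⟩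
  shift (xPow (2 + j))               ≈⟨ xPow-suc (2 + j) ⟨
  xPow (3 + j)                       ∎
  where
  open SetoidReasoning (ℕ →-setoid ℤ)
  U² = oneMinusX ^S 2
  Φ = oneMinusXMinusX²
  Φʲ = oneMinusXMinusX² ^S j

mainTheorem12 : (d : ℕ) → 3 ≤ d → (n : ℕ) →
    (B¹ (incPat d) ⊛ ((oneMinusX ^S 2) ⊛ (oneMinusXMinusX² ^S (d ∸ 2)))) n ≡ xPow d n
mainTheorem12 (suc (suc (suc j))) (s≤s (s≤s (s≤s _))) = B-⊛-denominator (suc j)
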